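{- Let $A\subset\mathbb{Z}$ be an extremal set with cardinality $k$ which is the union of two segments. Then $A$ is Freiman isomorphic of order 2 to one of the following sets: (i) $[0,k+b-1]\setminus [1,b]\subset\mathbb{Z}$, with $\dim (A)=1$, $\mathrm{vol} (A)=k+b$ and $|2A|=2k-1+b$, for some $1\le b\le k-3$; or (ii) $([0,k_1-1]\times \{0\})\cup ([0,k_2-1]\times \{1\})\subset\mathbb{Z}^2$ with $k_1+k_2=k$, $k_1,k_2\ge 1$, with $\dim (A)=2$, $\mathrm{vol} (A)=k$ and $|2A|=3k-3$.
   Context: For integers $m\le n$, $[m,n]=\{m,\dots,n\}$; a segment is a set of this form. $2A=A+A$. Two sets $A\subset G$, $B\subset G'$ in abelian groups are Freiman isomorphic of order 2 if there is a bijection $\phi:A\to B$ with $x+y=z+t \iff \phi(x)+\phi(y)=\phi(z)+\phi(t)$ for all $x,y,z,t\in A$. The dimension $\dim(A)$ of a finite set is the largest $d$ such that some $B\subset\mathbb{Z}^d$ not contained in a hyperplane is Freiman isomorphic of order 2 to $A$. The volume $\mathrm{vol}(A)$ of a $d$-dimensional set $A$ is the minimum, over all $B\subset\mathbb{Z}^d$ Freiman isomorphic of order 2 to $A$, of the number of lattice points in the convex hull of $B$. Let $\mathrm{vol}(k,T,d)=\max\{\mathrm{vol}(A): A\subset\mathbb{N},\ |A|=k,\ |2A|=T,\ \dim(A)=d\}$; $A$ is extremal if $\mathrm{vol}(A)=\mathrm{vol}(|A|,|2A|,\dim(A))$. A set $A\subset\mathbb{Z}$ is the union of $s$ segments if $A=P_1\cup\dots\cup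 P_s$ with each $P_i$ a segment of length $k_i$, $\max P_i+1<\min P_{i+1}$ for $1\le i<s$, and $k_i>1$ for some $i$. -}

module Defs where

open import Data.Nat as ℕ using (ℕ; zero; suc)
open import Data.Integer as ℤ using (ℤ; +_)
open import Data.Rational as ℚ using (ℚ; 0ℚ; 1ℚ)
open import Data.Fin using (Fin)
open import Data.Vec as Vec using (Vec; []; _∷_)
open import Data.Vec.Properties using (≡-dec)
open import Data.List as List using (List; allFin; concatMap; length; deduplicate)
open import Data.List.Membership.Propositional using (_∈_)
open import Data.List.Relation.Unary.Unique.Propositional using (Unique)
open import Data.Product using (Σ; ∃; _×_; _,_)
open import Data.Sum using (_⊎_)
open import Relation.Nullary using (¬_)
open import Relation.Binary.PropositionalEquality using (_≡_; _≢_)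
open import Relation.Binary.Definitions using (DecidableEquality)
open import Function using (_⇔_)
open import Function.Definitions using (Injective)

record FinSet (G : Set) : Set where
  field
    size : ℕ
    elt  : Fin size → G
    inj  : Injective _≡_ _≡_ elt
open FinSet public

_∈ₛ_ : {G : Set} → G → FinSet G → Set
x ∈ₛ A = ∃ λ i → elt A i ≡ x

Zd : ℕ → Set
Zd d = Vec ℤ d

_+ᵛ_ : {d : ℕ} → Zd d → Zd d → Zd d
_+ᵛ_ = Vec.zipWith ℤ._+_

0ᵛ : {d : ℕ} → Zd d
0ᵛ = Vec.replicate _ (+ 0)

dot : {d : ℕ} → Zd d → Zd d → ℤ
dot u v = Vec.foldr _ ℤ._+_ (+ 0) (Vec.zipWith ℤ._*_ u v)

sumsetSize : {G : Set} → DecidableEquality G → (G → G → G) → FinSet G → ℕ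
sumsetSize _≟_ _⊕_ A =
  length (deduplicate _≟_
    (concatMap (λ i → List.map (λ j → elt A i ⊕ elt A j) (allFin (size A)))
               (allFin (size A))))

sumsetSizeℤ : FinSet ℤ → ℕ
sumsetSizeℤ = sumsetSize ℤ._≟_ ℤ._+_

FreimanIsoTo : {G G' : Set} → (G → G → G) → (G' → G' → G') →
               FinSet G → (G' → Set) → Set
FreimanIsoTo _⊕_ _⊕'_ A S =
  Σ (Fin (size A) → _) λ φ →
    Injective _≡_ _≡_ φ ×
    (∀ y → S y ⇔ (∃ λ i → φ i ≡ y)) ×
    (∀ i j l m → (elt A i ⊕ elt A j ≡ elt A l ⊕ elt A m)
                 ⇔ (φ i ⊕' φ j ≡ φ l ⊕' φ m))

FreimanIso : {d : ℕ} → FinSet ℤ → FinSet (Zd d) → Set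
FreimanIso A B = FreimanIsoTo ℤ._+_ _+ᵛ_ A (λ y → y ∈ₛ B)

InHyperplane : {d : ℕ} → FinSet (Zd d) → Set
InHyperplane {d} B =
  Σ (Zd d) λ c → c ≢ 0ᵛ × (∃ λ t → ∀ i → dot c (elt B i) ≡ t)

Dim : FinSet ℤ → ℕ → Set
Dim A d =
  (Σ (FinSet (Zd d)) λ B → ¬ InHyperplane B × FreimanIso A B) ×
  (∀ d' (B : FinSet (Zd d')) → ¬ InHyperplane B → FreimanIso A B → d' ℕ.≤ d)

toℚ : ℤ → ℚ
toℚ z = z ℚ./ 1

sumFin : (n : ℕ) → (Fin n → ℚ) → ℚ
sumFin zero    f = 0ℚ
sumFin (suc n) f = f Fin.zero ℚ.+ sumFin n (λ i → f (Fin.suc i))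
  where import Data.Fin as Fin

InHull : {d : ℕ} → FinSet (Zd d) → Zd d → Set
InHull {d} B x =
  Σ (Fin (size B) → ℚ) λ λ' →
    (∀ i → 0ℚ ℚ.≤ λ' i) ×
    (sumFin (size B) λ' ≡ 1ℚ) ×
    (∀ (r : Fin d) →
       sumFin (size B) (λ i → λ' i ℚ.* toℚ (Vec.lookup (elt B i) r))
         ≡ toℚ (Vec.lookup x r))

HullCount : {d : ℕ} → FinSet (Zd d) → ℕ → Set
HullCount {d} B n =
  Σ (List (Zd d)) λ L →
    Unique L × (∀ x → (x ∈ L) ⇔ InHull B x) × (length L ≡ n)

Vol : FinSet ℤ → ℕ → ℕ → Set
Vol A d v =
  (Σ (FinSet (Zd d)) λ B → FreimanIso A B × HullCount B v) ×
  (∀ (B : FinSet (Zd d)) n → FreimanIso A B → HullCount B n → v ℕ.≤ n)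

InNat : FinSet ℤ → Set
InNat A = ∀ i → + 0 ℤ.≤ elt A i

Extremal : FinSet ℤ → Set
Extremal A =
  Σ ℕ λ d → Σ ℕ λ v → Dim A d × Vol A d v ×
    (∀ (A' : FinSet ℤ) d' v' → InNat A' →
       size A' ≡ size A → sumsetSizeℤ A' ≡ sumsetSizeℤ A →
       Dim A' d' → d' ≡ d → Vol A' d' v' → v' ℕ.≤ v)

UnionOfTwoSegments : FinSet ℤ → Set
UnionOfTwoSegments A =
  Σ ℤ λ m₁ → Σ ℤ λ n₁ → Σ ℤ λ m₂ → Σ ℤ λ n₂ →
    (m₁ ℤ.≤ n₁) × (n₁ ℤ.+ + 1 ℤ.< m₂) × (m₂ ℤ.≤ n₂) ×
    ((m₁ ℤ.< n₁) ⊎ (m₂ ℤ.< n₂)) ×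
    (∀ x → x ∈ₛ A ⇔ ((m₁ ℤ.≤ x × x ℤ.≤ n₁) ⊎ (m₂ ℤ.≤ x × x ℤ.≤ n₂)))

GapSet : ℕ → ℕ → ℤ → Set
GapSet k b x = (+ 0 ℤ.≤ x × x ℤ.≤ + (k ℕ.+ b) ℤ.- + 1) ×
               ¬ (+ 1 ℤ.≤ x × x ℤ.≤ + b)

TwoRows : ℕ → ℕ → Zd 2 → Set
TwoRows k₁ k₂ (x ∷ y ∷ []) =
  (y ≡ + 0 × + 0 ℤ.≤ x × x ℤ.< + k₁) ⊎ (y ≡ + 1 × + 0 ℤ.≤ x × x ℤ.< + k₂)

-- A translation puts A in the normal form [0, k₁) ∪ [k₁ + c, k₁ + c + k₂) with gap c ≥ 1.
-- A map preserving additive quadruples is affine on each segment (and with the same step on both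
-- when both have length ≥ 2), so Freiman images of the segments are arithmetic progressions;
-- this gives the dimension, and the volume as the lattice points of the hull of these progressions.
-- If k₁, k₂ ≤ c + 1, then t + δ(k₁ + c) ↦ (t, δ) is a Freiman isomorphism onto two rows of ℤ²:
-- case (ii), with |2A| = 3k − 3. Otherwise, after a reflection, the second segment is longer than
-- c + 1; one additive quadruple across the gap then makes every Freiman image collinear, so A is
-- one-dimensional of volume k + c. A singleton first segment gives the gap set of case (i). In the
-- remaining case 2k + c ≤ |2A| ≤ 3k − 4, and the gap set [0, k + b − 1] ∖ [1, b] with
-- b = |2A| + 1 − 2k has the same size and the same |2A| but the larger volume k + b, so A is not
-- extremal.

module Submission where

open import Defs
open import Data.Nat as ℕ using (ℕ; zero; suc; _+_; _*_; _∸_; _≤_; _<_; z≤n; s≤s)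
import Data.Nat.Properties as ℕP
open import Data.Nat.Coprimality as Cop using ()
import Data.Nat.GCD as NG
open import Data.Integer as ℤ using (ℤ; +_; -[1+_])
import Data.Integer.Properties as ℤP
open import Data.Rational as ℚ using (ℚ; 0ℚ; 1ℚ; mkℚ) renaming (_+_ to _+q_; _*_ to _*q_)
import Data.Rational.Properties as ℚP
open import Data.Rational.Solver using (module +-*-Solver)
open import Data.Nat.Tactic.RingSolver using () renaming (solve-∀ to solveℕ)
open import Data.Integer.Tactic.RingSolver using () renaming (solve-∀ to solveℤ)
open import Data.Fin as Fin using (Fin)
import Data.Fin.Properties as FinP
open import Data.Vec as Vec using (Vec; []; _∷_; lookup)
import Data.Vec.Properties as VecP
open import Data.List as List using (List; []; _∷_; _++_; allFin; concatMap; length; deduplicate)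
import Data.List.Properties as ListP
open import Data.List.Membership.Propositional using (_∈_)
import Data.List.Membership.Propositional.Properties as MemP
open import Data.List.Relation.Unary.Any as Any using (here; there)
open import Data.List.Relation.Unary.All as All using ()
open import Data.List.Relation.Unary.AllPairs as AllPairs using ()
open import Data.List.Relation.Unary.Unique.Propositional using (Unique)
import Data.List.Relation.Unary.Unique.Propositional.Properties as UniqP
import Data.List.Relation.Unary.Unique.DecPropositional.Properties as DecUniqP
open import Data.List.Relation.Binary.Disjoint.Propositional using (Disjoint)
open import Data.Product using (Σ; ∃; _×_; _,_; proj₁; proj₂)
open import Data.Sum using (_⊎_; inj₁; inj₂; map₂)
open import Data.Empty using (⊥; ⊥-elim)
open import Relation.Nullary using (¬_; Dec; yes; no)
open import Relation.Nullary.Decidable using (_×-dec_; _⊎-dec_)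
open import Relation.Binary.Definitions using (tri<; tri≈; tri>)
open import Relation.Binary.PropositionalEquality
  using (_≡_; _≢_; refl; sym; trans; cong; cong₂; subst; subst₂; module ≡-Reasoning)
open import Function using (_⇔_; mk⇔; id)
open import Function.Definitions using (Injective)
open import Function.Bundles using (Equivalence)

open Equivalence using (to; from)
open ≡-Reasoning

module _ {A : Set} where
  remove : ∀ {x : A} (ys : List A) → x ∈ ys → List A
  remove (y ∷ ys) (here _) = ys
  remove (y ∷ ys) (there p) = y ∷ remove ys p

  length-remove : ∀ {x : A} (ys : List A) (p : x ∈ ys) → length ys ≡ suc (length (remove ys p))
  length-remove (y List.∷ ys) (here _) = refl
  length-remove (y List.∷ ys) (there p) = cong suc (length-remove ys p)

  ∈-remove : ∀ {x z : A} (ys : List A) (p : x ∈ ys) → z ∈ ys → z ≢ x → z ∈ remove ys p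
  ∈-remove (y List.∷ ys) (here x≡y) (here z≡y) z≢x = ⊥-elim (z≢x (trans z≡y (sym x≡y)))
  ∈-remove (y List.∷ ys) (here _) (there q) z≢x = q
  ∈-remove (y List.∷ ys) (there p) (here z≡y) z≢x = here z≡y
  ∈-remove (y List.∷ ys) (there p) (there q) z≢x = there (∈-remove ys p q z≢x)

  unique-length-≤ : (xs ys : List A) → Unique xs → (∀ {x} → x ∈ xs → x ∈ ys) → length xs ≤ length ys
  unique-length-≤ List.[] ys u sub = z≤n
  unique-length-≤ (x List.∷ xs) ys (nx AllPairs.∷ u) sub =
    subst (suc (length xs) ≤_) (sym (length-remove ys px))
      (s≤s (unique-length-≤ xs (remove ys px) u (λ {z} z∈ → ∈-remove ys px (sub (there z∈))
         (λ z≡x → All.lookup nx z∈ (sym z≡x)))))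
    where
    px : x ∈ ys
    px = sub (here refl)

  unique-length-≡ : (xs ys : List A) → Unique xs → Unique ys → (∀ x → x ∈ xs ⇔ x ∈ ys) →
                length xs ≡ length ys
  unique-length-≡ xs ys ux uy eq = ℕP.≤-antisym (unique-length-≤ xs ys ux (to (eq _)))
                                            (unique-length-≤ ys xs uy (from (eq _)))

IsSum : FinSet ℤ → ℤ → Set
IsSum A x = Σ (Fin (size A)) λ i → Σ (Fin (size A)) λ j → elt A i ℤ.+ elt A j ≡ x

sumList : FinSet ℤ → List ℤ
sumList A = concatMap (λ i → List.map (λ j → elt A i ℤ.+ elt A j) (allFin (size A))) (allFin (size A))

sumList⁺ : (A : FinSet ℤ) {x : ℤ} → IsSum A x → x ∈ sumList A
sumList⁺ A (i , j , eq) = MemP.∈-concatMap⁺ (λ i → List.map (λ j → elt A i ℤ.+ elt A j) (allFin (size A))) (Any.map (λ {refl → q}) (MemP.∈-allFin i))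
  where q = subst (_∈ List.map (λ j → elt A i ℤ.+ elt A j) (allFin (size A))) eq
                  (MemP.∈-map⁺ (λ j → elt A i ℤ.+ elt A j) (MemP.∈-allFin j))

sumList⁻ : (A : FinSet ℤ) {x : ℤ} → x ∈ sumList A → IsSum A x
sumList⁻ A p with Any.satisfied (MemP.∈-concatMap⁻ (λ i → List.map (λ j → elt A i ℤ.+ elt A j) (allFin (size A))) {xs = allFin (size A)} p)
... | i , q with MemP.∈-map⁻ (λ j → elt A i ℤ.+ elt A j) q
... | j , _ , eq = i , j , sym eq

sumsetList : FinSet ℤ → List ℤ
sumsetList A = deduplicate ℤ._≟_ (sumList A)

sumsetList-unique : (A : FinSet ℤ) → Unique (sumsetList A)
sumsetList-unique A = DecUniqP.deduplicate-! ℤ._≟_ (sumList A)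

sumsetList⁺ : (A : FinSet ℤ) {x : ℤ} → IsSum A x → x ∈ sumsetList A
sumsetList⁺ A s = MemP.∈-deduplicate⁺ ℤ._≟_ (sumList⁺ A s)

sumsetList⁻ : (A : FinSet ℤ) {x : ℤ} → x ∈ sumsetList A → IsSum A x
sumsetList⁻ A p = sumList⁻ A (MemP.∈-deduplicate⁻ ℤ._≟_ (sumList A) p)

sumsetSize≡length : (A : FinSet ℤ) (U : List ℤ) → Unique U → (∀ x → x ∈ U ⇔ IsSum A x) →
        sumsetSizeℤ A ≡ length U
sumsetSize≡length A U uU eq = unique-length-≡ (sumsetList A) U (sumsetList-unique A) uU
  (λ x → mk⇔ (λ p → from (eq x) (sumsetList⁻ A p)) (λ p → sumsetList⁺ A (to (eq x) p)))

length≤sumsetSize : (A : FinSet ℤ) (U : List ℤ) → Unique U → (∀ {x} → x ∈ U → IsSum A x) →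
        length U ≤ sumsetSizeℤ A
length≤sumsetSize A U uU sub = unique-length-≤ U (sumsetList A) uU (λ p → sumsetList⁺ A (sub p))

sumsetSize≤length : (A : FinSet ℤ) (W : List ℤ) → (∀ {x} → IsSum A x → x ∈ W) →
        sumsetSizeℤ A ≤ length W
sumsetSize≤length A W sub = unique-length-≤ (sumsetList A) W (sumsetList-unique A) (λ p → sub (sumsetList⁻ A p))

elements : {G : Set} → FinSet G → List G
elements A = List.map (elt A) (allFin (size A))

elements-unique : {G : Set} (A : FinSet G) → Unique (elements A)
elements-unique A = UniqP.map⁺ (inj A) (UniqP.allFin⁺ (size A))

length-elements : {G : Set} (A : FinSet G) → length (elements A) ≡ size A
length-elements A = trans (ListP.length-map (elt A) (allFin (size A))) (ListP.length-tabulate id)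

elements⁺ : {G : Set} (A : FinSet G) {x : G} → x ∈ₛ A → x ∈ elements A
elements⁺ A (i , refl) = MemP.∈-map⁺ (elt A) (MemP.∈-allFin i)

elements⁻ : {G : Set} (A : FinSet G) {x : G} → x ∈ elements A → x ∈ₛ A
elements⁻ A p with MemP.∈-map⁻ (elt A) p
... | i , _ , eq = i , sym eq

size≡length : {G : Set} (A : FinSet G) (U : List G) → Unique U → (∀ x → x ∈ U ⇔ x ∈ₛ A) →
          size A ≡ length U
size≡length A U uU eq = trans (sym (length-elements A)) (unique-length-≡ (elements A) U (elements-unique A) uU
  (λ x → mk⇔ (λ p → from (eq x) (elements⁻ A p)) (λ p → elements⁺ A (to (eq x) p))))

-- Segments and two-segment sets

InRange : ℕ → ℕ → ℕ → Set
InRange s n m = s ≤ m × m < s + n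

InRangeℤ : ℕ → ℕ → ℤ → Set
InRangeℤ s n x = Σ ℕ λ m → x ≡ + m × InRange s n m

range : ℕ → ℕ → List ℤ
range s zero = []
range s (suc n) = + s ∷ range (suc s) n

length-range : ∀ s n → length (range s n) ≡ n
length-range s zero = refl
length-range s (suc n) = cong suc (length-range (suc s) n)

range⁺ : ∀ {s n m} → InRange s n m → + m ∈ range s n
range⁺ {s} {zero} {m} (s≤m , m<s+0) = ⊥-elim (ℕP.<-irrefl refl (ℕP.≤-<-trans s≤m (subst (m <_) (ℕP.+-identityʳ s) m<s+0)))
range⁺ {s} {suc n} {m} (s≤m , m<) with s ℕP.≟ m
... | yes refl = here refl
... | no s≢m = there (range⁺ (ℕP.≤∧≢⇒< s≤m s≢m , subst (m <_) (ℕP.+-suc s n) m<))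

range⁻ : ∀ {s n x} → x ∈ range s n → InRangeℤ s n x
range⁻ {s} {suc n} (here refl) = s , refl , ℕP.≤-refl , ℕP.m<m+n s (s≤s z≤n)
range⁻ {s} {suc n} (there p) with range⁻ {suc s} {n} p
... | m , eq , s<m , m< = m , eq , ℕP.<⇒≤ s<m , subst (m <_) (sym (ℕP.+-suc s n)) m<

range-unique : ∀ s n → Unique (range s n)
range-unique s zero = AllPairs.[]
range-unique s (suc n) = All.tabulate (λ {x} x∈ eq → helper x∈ eq) AllPairs.∷ range-unique (suc s) n
  where
  helper : ∀ {x} → x ∈ range (suc s) n → + s ≡ x → ⊥
  helper x∈ refl with range⁻ x∈
  ... | m , refl , s<m , _ = ℕP.<-irrefl refl s<m

range-disjoint : ∀ s n s' n' → s + n ≤ s' → Disjoint (range s n) (range s' n')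
range-disjoint s n s' n' le (p , q) with range⁻ p | range⁻ q
... | m , refl , _ , m< | .m , refl , s'≤m , _ = ℕP.<-irrefl refl (ℕP.<-≤-trans m< (ℕP.≤-trans le s'≤m))

split-sum : ∀ s1 a1 s2 a2 x → s1 + s2 ≤ x → x ≤ s1 + a1 + (s2 + a2) →
       Σ ℕ λ u → Σ ℕ λ v → InRange s1 (suc a1) u × InRange s2 (suc a2) v × u + v ≡ x
split-sum s1 a1 s2 a2 x lo hi with x ℕ.≤? s1 + a1 + s2
... | yes x≤ = x ∸ s2 , s2 , (ℕP.m+n≤o⇒m≤o∸n _ lo , subst (x ∸ s2 <_) (sym (ℕP.+-suc s1 a1)) (s≤s le2)) ,
               (ℕP.≤-refl , ℕP.m<m+n s2 (s≤s z≤n)) , ℕP.m∸n+n≡m s2≤x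
  where
  s2≤x : s2 ≤ x
  s2≤x = ℕP.≤-trans (ℕP.m≤n+m s2 s1) lo
  le2 : x ∸ s2 ≤ s1 + a1
  le2 = subst (x ∸ s2 ≤_) (ℕP.m+n∸n≡m (s1 + a1) s2) (ℕP.∸-monoˡ-≤ s2 x≤)
... | no x≰ = s1 + a1 , x ∸ (s1 + a1) , (ℕP.m≤m+n s1 a1 , subst (s1 + a1 <_) (sym (ℕP.+-suc s1 a1)) ℕP.≤-refl) ,
      (lo2 , hi2) , ℕP.m+[n∸m]≡n le1
  where
  lt : s1 + a1 + s2 < x
  lt = ℕP.≰⇒> x≰
  le1 : s1 + a1 ≤ x
  le1 = ℕP.≤-trans (ℕP.m≤m+n (s1 + a1) s2) (ℕP.<⇒≤ lt)
  lo2 : s2 ≤ x ∸ (s1 + a1)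
  lo2 = ℕP.m+n≤o⇒m≤o∸n _ (subst (_≤ x) (ℕP.+-comm (s1 + a1) s2) (ℕP.<⇒≤ lt))
  hi2 : x ∸ (s1 + a1) < s2 + suc a2
  hi2 = subst (x ∸ (s1 + a1) <_) (sym (ℕP.+-suc s2 a2))
          (s≤s (subst (x ∸ (s1 + a1) ≤_) (ℕP.m+n∸m≡n (s1 + a1) (s2 + a2))
             (ℕP.∸-monoˡ-≤ (s1 + a1) hi)))

InTwoSeg : ℕ → ℕ → ℕ → ℕ → Set
InTwoSeg k1 c k2 m = InRange 0 k1 m ⊎ InRange (k1 + c) k2 m

TwoSeg : ℕ → ℕ → ℕ → ℤ → Set
TwoSeg k1 c k2 x = Σ ℕ λ m → x ≡ + m × InTwoSeg k1 c k2 m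

TwoSegSum : ℕ → ℕ → ℕ → ℤ → Set
TwoSegSum k1 c k2 x = Σ ℕ λ u → Σ ℕ λ v → InTwoSeg k1 c k2 u × InTwoSeg k1 c k2 v × x ≡ + (u + v)

≤≡ : ∀ {a b c} → a ≤ b → b ≡ c → a ≤ c
≤≡ p refl = p
≡≤ : ∀ {a b c} → a ≡ b → b ≤ c → a ≤ c
≡≤ refl p = p

<+suc⇒≤ : ∀ {m s a} → m < s + suc a → m ≤ s + a
<+suc⇒≤ {m} {s} {a} p = ℕP.≤-pred (≤≡ p (ℕP.+-suc s a))

≤⇒<+suc : ∀ {m s a} → m ≤ s + a → m < s + suc a
≤⇒<+suc {m} {s} {a} p = ≤≡ (s≤s p) (sym (ℕP.+-suc s a))

InRange⇒bounds : ∀ {s a m} → InRange s (suc a) m → s ≤ m × m ≤ s + a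
InRange⇒bounds (p , q) = p , <+suc⇒≤ q

bounds⇒InRange : ∀ {s a m} → s ≤ m → m ≤ s + a → InRange s (suc a) m
bounds⇒InRange p q = p , ≤⇒<+suc q

disjoint-++ʳ : ∀ {xs ys zs : List ℤ} → Disjoint xs ys → Disjoint xs zs → Disjoint xs (ys ++ zs)
disjoint-++ʳ {ys = ys} d1 d2 (p , q) with MemP.∈-++⁻ ys q
... | inj₁ q1 = d1 (p , q1)
... | inj₂ q2 = d2 (p , q2)

≡+⇒∸≡ : ∀ {n m} k → n ≡ k + m → n ∸ k ≡ m
≡+⇒∸≡ {m = m} k refl = ℕP.m+n∸m≡n k m

module TwoSegSet (k1 c k2 : ℕ) (A : FinSet ℤ) (memA : ∀ x → x ∈ₛ A ⇔ TwoSeg k1 c k2 x) where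

  isSum⇔twoSegSum : ∀ x → IsSum A x ⇔ TwoSegSum k1 c k2 x
  isSum⇔twoSegSum x = mk⇔ f g
    where
    f : IsSum A x → TwoSegSum k1 c k2 x
    f (i , j , eq) with to (memA (elt A i)) (i , refl) | to (memA (elt A j)) (j , refl)
    ... | u , eu , pu | v , ev , pv = u , v , pu , pv , trans (sym eq) (cong₂ ℤ._+_ eu ev)
    g : TwoSegSum k1 c k2 x → IsSum A x
    g (u , v , pu , pv , refl) with from (memA (+ u)) (u , refl , pu) | from (memA (+ v)) (v , refl , pv)
    ... | i , ei | j , ej = i , j , cong₂ ℤ._+_ ei ej

  sumset≡length : (U : List ℤ) → Unique U → (∀ x → x ∈ U ⇔ TwoSegSum k1 c k2 x) → sumsetSizeℤ A ≡ length U
  sumset≡length U uU eq = sumsetSize≡length A U uU (λ x → mk⇔ (λ p → from (isSum⇔twoSegSum x) (to (eq x) p))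
                                               (λ p → from (eq x) (to (isSum⇔twoSegSum x) p)))

  members : List ℤ
  members = range 0 k1 ++ range (k1 + c) k2

  size≡k₁+k₂ : size A ≡ k1 + k2
  size≡k₁+k₂ = trans (size≡length A members (UniqP.++⁺ (range-unique 0 k1) (range-unique (k1 + c) k2)
                    (range-disjoint 0 k1 (k1 + c) k2 (ℕP.m≤m+n k1 c)))
                  (λ x → mk⇔ (λ p → from (memA x) (f p)) (λ p → g (to (memA x) p))))
                (trans (ListP.length-++ (range 0 k1)) (cong₂ _+_ (length-range 0 k1) (length-range (k1 + c) k2)))
    where
    f : ∀ {x} → x ∈ members → TwoSeg k1 c k2 x
    f {x} p with MemP.∈-++⁻ (range 0 k1) p
    ... | inj₁ q with range⁻ q
    ...   | m , e , r = m , e , inj₁ r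
    f {x} p | inj₂ q with range⁻ q
    ...   | m , e , r = m , e , inj₂ r
    g : ∀ {x} → TwoSeg k1 c k2 x → x ∈ members
    g (m , refl , inj₁ r) = MemP.∈-++⁺ˡ (range⁺ r)
    g (m , refl , inj₂ r) = MemP.∈-++⁺ʳ (range 0 k1) (range⁺ r)

-- Sumsets of two-segment sets

module SumsetOfShortSegments (a1 c a2 : ℕ) (h1 : a1 ≤ c) (h2 : a2 ≤ c) (A : FinSet ℤ)
               (memA : ∀ x → x ∈ₛ A ⇔ TwoSeg (suc a1) c (suc a2) x) where
  open TwoSegSet (suc a1) c (suc a2) A memA

  s2 : ℕ
  s2 = suc a1 + c

  B0 asℤ¹ asTwoRows U : List ℤ
  B0 = range 0 (suc (a1 + a1))
  asℤ¹ = range s2 (suc (a1 + a2))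
  asTwoRows = range (s2 + s2) (suc (a2 + a2))
  U = B0 ++ (asℤ¹ ++ asTwoRows)

  uU : Unique U
  uU = UniqP.++⁺ (range-unique _ _) (UniqP.++⁺ (range-unique _ _) (range-unique _ _) d12)
               (disjoint-++ʳ d01 d02)
    where
    d01 : Disjoint B0 asℤ¹
    d01 = range-disjoint _ _ _ _ (s≤s (ℕP.+-monoʳ-≤ a1 h1))
    d12 : Disjoint asℤ¹ asTwoRows
    d12 = range-disjoint _ _ _ _ (ℕP.+-monoʳ-≤ s2 (s≤s (ℕP.+-monoʳ-≤ a1 h2)))
    d02 : Disjoint B0 asTwoRows
    d02 = range-disjoint _ _ _ _ (ℕP.≤-trans (s≤s (ℕP.+-monoʳ-≤ a1 h1)) (ℕP.m≤m+n s2 s2))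

  s11 : ∀ {u v} → InRange 0 (suc a1) u → InRange 0 (suc a1) v → + (u + v) ∈ U
  s11 pu pv = MemP.∈-++⁺ˡ (range⁺ (bounds⇒InRange z≤n (ℕP.+-mono-≤ (proj₂ (InRange⇒bounds pu)) (proj₂ (InRange⇒bounds pv)))))

  s12 : ∀ {u v} → InRange 0 (suc a1) u → InRange s2 (suc a2) v → + (u + v) ∈ U
  s12 {u} {v} pu pv = MemP.∈-++⁺ʳ B0 (MemP.∈-++⁺ˡ (range⁺ (bounds⇒InRange (ℕP.≤-trans (proj₁ (InRange⇒bounds pv)) (ℕP.m≤n+m v u))
       (≤≡ (ℕP.+-mono-≤ (proj₂ (InRange⇒bounds pu)) (proj₂ (InRange⇒bounds pv))) (rearrange a1 s2 a2)))))
    where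
    rearrange : ∀ a1 s2 a2 → a1 + (s2 + a2) ≡ s2 + (a1 + a2)
    rearrange = solveℕ

  s22 : ∀ {u v} → InRange s2 (suc a2) u → InRange s2 (suc a2) v → + (u + v) ∈ U
  s22 {u} {v} pu pv = MemP.∈-++⁺ʳ B0 (MemP.∈-++⁺ʳ asℤ¹ (range⁺ (bounds⇒InRange (ℕP.+-mono-≤ (proj₁ (InRange⇒bounds pu)) (proj₁ (InRange⇒bounds pv)))
       (≤≡ (ℕP.+-mono-≤ (proj₂ (InRange⇒bounds pu)) (proj₂ (InRange⇒bounds pv))) (rearrange s2 a2)))))
    where
    rearrange : ∀ s2 a2 → s2 + a2 + (s2 + a2) ≡ s2 + s2 + (a2 + a2)
    rearrange = solveℕ

  toU : ∀ x → TwoSegSum (suc a1) c (suc a2) x → x ∈ U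
  toU x (u , v , inj₁ pu , inj₁ pv , refl) = s11 pu pv
  toU x (u , v , inj₁ pu , inj₂ pv , refl) = s12 pu pv
  toU x (u , v , inj₂ pu , inj₁ pv , refl) = subst (_∈ U) (cong +_ (ℕP.+-comm v u)) (s12 pv pu)
  toU x (u , v , inj₂ pu , inj₂ pv , refl) = s22 pu pv

  fromU : ∀ x → x ∈ U → TwoSegSum (suc a1) c (suc a2) x
  fromU x p with MemP.∈-++⁻ B0 p
  ... | inj₁ q with range⁻ q
  ...   | m , refl , r with split-sum 0 a1 0 a1 m z≤n (<+suc⇒≤ {s = 0} (proj₂ r))
  ...     | u , v , pu , pv , refl = u , v , inj₁ pu , inj₁ pv , refl
  fromU x p | inj₂ q with MemP.∈-++⁻ asℤ¹ q
  ... | inj₁ q1 with range⁻ q1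
  ...   | m , refl , r with split-sum 0 a1 s2 a2 m (proj₁ r) (≤≡ (<+suc⇒≤ {s = s2} {a = a1 + a2} (proj₂ r)) (rearrange s2 a1 a2))
    where
    rearrange : ∀ s2 a1 a2 → s2 + (a1 + a2) ≡ 0 + a1 + (s2 + a2)
    rearrange = solveℕ
  ...     | u , v , pu , pv , refl = u , v , inj₁ pu , inj₂ pv , refl
  fromU x p | inj₂ q | inj₂ q2 with range⁻ q2
  ...   | m , refl , r with split-sum s2 a2 s2 a2 m (proj₁ r) (≤≡ (<+suc⇒≤ {s = s2 + s2} {a = a2 + a2} (proj₂ r)) (rearrange s2 a2))
    where
    rearrange : ∀ s2 a2 → s2 + s2 + (a2 + a2) ≡ s2 + a2 + (s2 + a2)
    rearrange = solveℕ
  ...     | u , v , pu , pv , refl = u , v , inj₂ pu , inj₂ pv , refl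

  sumset≡3k∸3 : sumsetSizeℤ A ≡ 3 * (suc a1 + suc a2) ∸ 3
  sumset≡3k∸3 = trans (sumset≡length U uU (λ x → mk⇔ (fromU x) (toU x)))
    (trans (ListP.length-++ B0 {asℤ¹ ++ asTwoRows}) (trans (cong₂ _+_ (length-range 0 (suc (a1 + a1))) (trans (ListP.length-++ asℤ¹ {asTwoRows})
       (cong₂ _+_ (length-range s2 (suc (a1 + a2))) (length-range (s2 + s2) (suc (a2 + a2))))))
     (sym (≡+⇒∸≡ 3 (count a1 a2)))))
    where
    count : ∀ a1 a2 → 3 * (suc a1 + suc a2) ≡ 3 + (suc (a1 + a1) + (suc (a1 + a2) + suc (a2 + a2)))
    count = solveℕ

module SumsetOfGapSet (c a2 : ℕ) (h : suc c ≤ a2) (A : FinSet ℤ)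
               (memA : ∀ x → x ∈ₛ A ⇔ TwoSeg 1 c (suc a2) x) where
  open TwoSegSet 1 c (suc a2) A memA

  L : ℕ
  L = suc (suc (c + (a2 + a2)))
  U : List ℤ
  U = range 0 1 ++ range (suc c) L

  uU : Unique U
  uU = UniqP.++⁺ (range-unique _ _) (range-unique _ _) (range-disjoint 0 1 (suc c) L (s≤s z≤n))

  inB1 : ∀ {m} → suc c ≤ m → m ≤ suc c + suc (c + (a2 + a2)) → + m ∈ U
  inB1 lo hi = MemP.∈-++⁺ʳ (range 0 1) (range⁺ (bounds⇒InRange lo hi))

  twice-max : ∀ c a2 → suc c + a2 + (suc c + a2) ≡ suc c + suc (c + (a2 + a2))
  twice-max = solveℕ

  a2≤ : a2 ≤ suc (c + (a2 + a2))
  a2≤ = ℕP.m≤n⇒m≤1+n (ℕP.≤-trans (ℕP.m≤n+m a2 a2) (ℕP.m≤n+m (a2 + a2) c))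

  toU : ∀ x → TwoSegSum 1 c (suc a2) x → x ∈ U
  toU x (u , v , inj₁ (_ , s≤s z≤n) , inj₁ (_ , s≤s z≤n) , refl) = here refl
  toU x (u , v , inj₁ (_ , s≤s z≤n) , inj₂ pv , refl) =
    inB1 (proj₁ (InRange⇒bounds pv)) (ℕP.≤-trans (proj₂ (InRange⇒bounds pv)) (ℕP.+-monoʳ-≤ (suc c) a2≤))
  toU x (u , v , inj₂ pu , inj₁ (_ , s≤s z≤n) , refl) = subst (_∈ U) (cong +_ (sym (ℕP.+-identityʳ u)))
    (inB1 (proj₁ (InRange⇒bounds pu)) (ℕP.≤-trans (proj₂ (InRange⇒bounds pu)) (ℕP.+-monoʳ-≤ (suc c) a2≤)))
  toU x (u , v , inj₂ pu , inj₂ pv , refl) =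
    inB1 (ℕP.≤-trans (proj₁ (InRange⇒bounds pu)) (ℕP.m≤m+n u v))
         (≤≡ (ℕP.+-mono-≤ (proj₂ (InRange⇒bounds pu)) (proj₂ (InRange⇒bounds pv))) (twice-max c a2))

  fromU : ∀ x → x ∈ U → TwoSegSum 1 c (suc a2) x
  fromU x (here refl) = 0 , 0 , inj₁ (z≤n , s≤s z≤n) , inj₁ (z≤n , s≤s z≤n) , refl
  fromU x (there q) with range⁻ q
  ... | m , refl , r with m ℕ.≤? suc c + a2
  ...   | yes le = 0 , m , inj₁ (z≤n , s≤s z≤n) , inj₂ (bounds⇒InRange (proj₁ r) le) , refl
  ...   | no nle with split-sum (suc c) a2 (suc c) a2 m lo (≤≡ (<+suc⇒≤ {s = suc c} {a = suc (c + (a2 + a2))} (proj₂ r)) (sym (twice-max c a2)))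
    where
    lo : suc c + suc c ≤ m
    lo = ℕP.≤-trans (ℕP.+-monoʳ-≤ (suc c) h) (ℕP.<⇒≤ (ℕP.≰⇒> nle))
  ...     | u , v , pu , pv , refl = u , v , inj₂ pu , inj₂ pv , refl

  sumset≡2k+b∸1 : sumsetSizeℤ A ≡ 2 * (1 + suc a2) + c ∸ 1
  sumset≡2k+b∸1 = trans (sumset≡length U uU (λ x → mk⇔ (fromU x) (toU x)))
    (trans (ListP.length-++ (range 0 1) {range (suc c) L}) (trans (cong suc (length-range (suc c) L))
      (sym (≡+⇒∸≡ 1 (count c a2)))))
    where
    count : ∀ c a2 → 2 * (1 + suc a2) + c ≡ 1 + (1 + suc (suc (c + (a2 + a2))))
    count = solveℕ

module SumsetWithLongSegment (a1' c a2 : ℕ) (hc : 1 ≤ c) (h : suc c ≤ a2) (A : FinSet ℤ)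
               (memA : ∀ x → x ∈ₛ A ⇔ TwoSeg (suc (suc a1')) c (suc a2) x) where
  a1 : ℕ
  a1 = suc a1'
  open TwoSegSet (suc a1) c (suc a2) A memA

  s2 : ℕ
  s2 = suc a1 + c

  Ll : ℕ
  Ll = suc (s2 + (a2 + a2))
  Ul W : List ℤ
  Ul = range 0 (suc (suc a1)) ++ range s2 Ll
  W = range 0 (suc (a1 + a1)) ++ range s2 Ll

  sumsLowerList-unique : Unique Ul
  sumsLowerList-unique = UniqP.++⁺ (range-unique _ _) (range-unique _ _)
          (range-disjoint 0 _ s2 _ (≡≤ (ℕP.+-comm 1 (suc a1)) (ℕP.+-monoʳ-≤ (suc a1) hc)))

  twice-max : ∀ s2 a2 → s2 + (s2 + (a2 + a2)) ≡ s2 + a2 + (s2 + a2)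
  twice-max = solveℕ

  hiB1 : ∀ {m} → m < s2 + Ll → m ≤ s2 + (s2 + (a2 + a2))
  hiB1 {m} p = <+suc⇒≤ {m} {s2} {s2 + (a2 + a2)} p

  fromUl : ∀ x → x ∈ Ul → TwoSegSum (suc a1) c (suc a2) x
  fromUl x p with MemP.∈-++⁻ (range 0 (suc (suc a1))) p
  ... | inj₁ q with range⁻ q
  ...   | m , refl , r with split-sum 0 a1 0 a1 m z≤n (ℕP.≤-trans (<+suc⇒≤ {s = 0} {a = suc a1} (proj₂ r)) (s≤s (ℕP.m≤n+m a1 a1')))
  ...     | u , v , pu , pv , refl = u , v , inj₁ pu , inj₁ pv , refl
  fromUl x p | inj₂ q with range⁻ q
  ... | m , refl , r with m ℕ.≤? s2 + (a1 + a2)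
  ...   | yes le with split-sum 0 a1 s2 a2 m (proj₁ r) (≤≡ le (rearrange s2 a1 a2))
    where
    rearrange : ∀ s2 a1 a2 → s2 + (a1 + a2) ≡ 0 + a1 + (s2 + a2)
    rearrange = solveℕ
  ...     | u , v , pu , pv , refl = u , v , inj₁ pu , inj₂ pv , refl
  fromUl x p | inj₂ q | m , refl , r | no nle with split-sum s2 a2 s2 a2 m lo (≤≡ (hiB1 (proj₂ r)) (twice-max s2 a2))
    where
    lo : s2 + s2 ≤ m
    lo = ℕP.≤-trans (≡≤ (cong (λ z → s2 + z) (sym (ℕP.+-suc a1 c))) (ℕP.+-monoʳ-≤ s2 (ℕP.+-monoʳ-≤ a1 h)))
                    (ℕP.<⇒≤ (ℕP.≰⇒> nle))
  ... | u , v , pu , pv , refl = u , v , inj₂ pu , inj₂ pv , refl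

  2k+c≤sumset : 2 * (suc a1 + suc a2) + c ≤ sumsetSizeℤ A
  2k+c≤sumset = ≡≤ (trans (sym (count a1 c a2)) (sym (trans (ListP.length-++ (range 0 (suc (suc a1))) {range s2 Ll})
               (cong₂ _+_ (length-range 0 (suc (suc a1))) (length-range s2 Ll)))))
              (length≤sumsetSize A Ul sumsLowerList-unique (λ {x} p → from (isSum⇔twoSegSum x) (fromUl x p)))
    where
    count : ∀ a1 c a2 → suc (suc a1) + suc (suc a1 + c + (a2 + a2)) ≡ 2 * (suc a1 + suc a2) + c
    count = solveℕ

  toW : ∀ x → TwoSegSum (suc a1) c (suc a2) x → x ∈ W
  toW x (u , v , inj₁ pu , inj₁ pv , refl) =
    MemP.∈-++⁺ˡ (range⁺ (bounds⇒InRange z≤n (ℕP.+-mono-≤ (proj₂ (InRange⇒bounds pu)) (proj₂ (InRange⇒bounds pv)))))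
  toW x (u , v , inj₁ pu , inj₂ pv , refl) = MemP.∈-++⁺ʳ (range 0 (suc (a1 + a1)))
    (range⁺ (bounds⇒InRange (ℕP.≤-trans (proj₁ (InRange⇒bounds pv)) (ℕP.m≤n+m v u))
       (ℕP.+-mono-≤ (ℕP.≤-trans (proj₂ (InRange⇒bounds pu)) (ℕP.m≤n⇒m≤1+n (ℕP.m≤m+n a1 c)))
                    (ℕP.≤-trans (proj₂ (InRange⇒bounds pv)) (ℕP.+-monoʳ-≤ s2 (ℕP.m≤n+m a2 a2))))))
  toW x (u , v , inj₂ pu , inj₁ pv , refl) = subst (_∈ W) (cong +_ (ℕP.+-comm v u)) (toW (+ (v + u)) (v , u , inj₁ pv , inj₂ pu , refl))
  toW x (u , v , inj₂ pu , inj₂ pv , refl) = MemP.∈-++⁺ʳ (range 0 (suc (a1 + a1)))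
    (range⁺ (bounds⇒InRange (ℕP.≤-trans (proj₁ (InRange⇒bounds pu)) (ℕP.m≤m+n u v))
       (≤≡ (ℕP.+-mono-≤ (proj₂ (InRange⇒bounds pu)) (proj₂ (InRange⇒bounds pv))) (sym (twice-max s2 a2)))))

  lenW : length W ≡ suc (a1 + a1) + Ll
  lenW = trans (ListP.length-++ (range 0 (suc (a1 + a1))) {range s2 Ll})
               (cong₂ _+_ (length-range 0 (suc (a1 + a1))) (length-range s2 Ll))

  sumset≤3k∸4 : sumsetSizeℤ A ≤ 3 * (suc a1 + suc a2) ∸ 4
  sumset≤3k∸4 with ℕP.m≤n⇒∃[o]m+o≡n h
  ... | e , refl = ℕP.≤-trans (sumsetSize≤length A W (λ {x} p → toW x (to (isSum⇔twoSegSum x) p)))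
      (≤≡ (ℕP.m≤m+n (length W) e) (trans (cong (λ z → z + e) lenW) (sym (≡+⇒∸≡ 4 (count a1 c e)))))
    where
    count : ∀ a1 c e → 3 * (suc a1 + suc (suc c + e)) ≡ 4 + ((suc (a1 + a1) + suc (suc a1 + c + (suc c + e + (suc c + e)))) + e)
    count = solveℕ

-- Convex hulls

ι : ℤ → ℚ
ι z = mkℚ z 0 (Cop.sym (Cop.1-coprimeTo ℤ.∣ z ∣))

mkℚ≡ι : ∀ p z → ℚ.↥ p ≡ z → ℚ.↧ p ≡ + 1 → p ≡ ι z
mkℚ≡ι (mkℚ n zero c) z refl refl = ℚP.mkℚ-cong refl refl

gcd[∣z∣,1]≡1 : ∀ z → NG.gcd ℤ.∣ z ∣ 1 ≡ 1
gcd[∣z∣,1]≡1 z = Cop.coprime⇒gcd≡1 (Cop.sym (Cop.1-coprimeTo ℤ.∣ z ∣))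

toℚ≡ι : ∀ z → toℚ z ≡ ι z
toℚ≡ι z = mkℚ≡ι (z ℚ./ 1) z
  (trans (sym (ℤP.*-identityʳ _)) (trans (cong (λ g → ℚ.↥ (z ℚ./ 1) ℤ.* + g) (sym (gcd[∣z∣,1]≡1 z))) (ℚP.↥-/ z 1)))
  (trans (sym (ℤP.*-identityʳ _)) (trans (cong (λ g → ℚ.↧ (z ℚ./ 1) ℤ.* + g) (sym (gcd[∣z∣,1]≡1 z))) (ℚP.↧-/ z 1)))

ι-+ : ∀ a b → ι a ℚ.+ ι b ≡ ι (a ℤ.+ b)
ι-+ a b = trans (ℚP./-cong {p₁ = a ℤ.* + 1 ℤ.+ b ℤ.* + 1} {q₁ = 1} (cong₂ ℤ._+_ (ℤP.*-identityʳ a) (ℤP.*-identityʳ b)) refl)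
                (toℚ≡ι (a ℤ.+ b))

ι-* : ∀ a b → ι a ℚ.* ι b ≡ ι (a ℤ.* b)
ι-* a b = toℚ≡ι (a ℤ.* b)

ι-neg : ∀ a → ℚ.- ι a ≡ ι (ℤ.- a)
ι-neg (+ zero) = refl
ι-neg (+ suc n) = refl
ι-neg -[1+ n ] = refl

ι-≤ : ∀ {a b} → a ℤ.≤ b → ι a ℚ.≤ ι b
ι-≤ {a} {b} p = ℚ.*≤* (subst₂ ℤ._≤_ (sym (ℤP.*-identityʳ a)) (sym (ℤP.*-identityʳ b)) p)

ι-≤⁻ : ∀ {a b} → ι a ℚ.≤ ι b → a ℤ.≤ b
ι-≤⁻ {a} {b} (ℚ.*≤* p) = subst₂ ℤ._≤_ (ℤP.*-identityʳ a) (ℤP.*-identityʳ b) p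

ι-inj : ∀ {a b} → ι a ≡ ι b → a ≡ b
ι-inj refl = refl

≤-respʳ-≡ : ∀ {a b c : ℚ} → a ℚ.≤ b → b ≡ c → a ℚ.≤ c
≤-respʳ-≡ p refl = p
≤-respˡ-≡ : ∀ {a b c : ℚ} → a ≡ b → b ℚ.≤ c → a ℚ.≤ c
≤-respˡ-≡ refl p = p

*-monoˡ-≤-0≤ : ∀ {r p q} → 0ℚ ℚ.≤ r → p ℚ.≤ q → r *q p ℚ.≤ r *q q
*-monoˡ-≤-0≤ {r} h pq = ℚP.*-monoˡ-≤-nonNeg r {{ℚ.nonNegative h}} pq

nonNeg*nonNeg : ∀ {p q} → 0ℚ ℚ.≤ p → 0ℚ ℚ.≤ q → 0ℚ ℚ.≤ p *q q
nonNeg*nonNeg {p} {q} hp hq = ≤-respˡ-≡ (sym (ℚP.*-zeroʳ p)) (*-monoˡ-≤-0≤ hp hq)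

nonNeg+nonNeg≡0 : ∀ {a b} → 0ℚ ℚ.≤ a → 0ℚ ℚ.≤ b → a +q b ≡ 0ℚ → a ≡ 0ℚ × b ≡ 0ℚ
nonNeg+nonNeg≡0 {a} {b} ha hb eq = a≡0 , trans (sym (ℚP.+-identityˡ b)) (trans (cong (_+q b) (sym a≡0)) eq)
  where
  a≤0 : a ℚ.≤ 0ℚ
  a≤0 = ≤-respʳ-≡ (≤-respˡ-≡ (sym (ℚP.+-identityʳ a)) (ℚP.+-monoʳ-≤ a hb)) eq
  a≡0 : a ≡ 0ℚ
  a≡0 = ℚP.≤-antisym a≤0 ha

*≡0⇒≡0⊎≡0 : ∀ p q → p *q q ≡ 0ℚ → p ≡ 0ℚ ⊎ q ≡ 0ℚ
*≡0⇒≡0⊎≡0 p q eq with p ℚP.≟ 0ℚ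
... | yes p≡0 = inj₁ p≡0
... | no p≢0 = inj₂ (begin
  q                ≡⟨ sym (ℚP.*-identityˡ q) ⟩
  1ℚ *q q          ≡⟨ cong (_*q q) (sym (ℚP.*-inverseˡ p)) ⟩
  p⁻¹ *q p *q q    ≡⟨ ℚP.*-assoc p⁻¹ p q ⟩
  p⁻¹ *q (p *q q)  ≡⟨ cong (p⁻¹ *q_) eq ⟩
  p⁻¹ *q 0ℚ        ≡⟨ ℚP.*-zeroʳ p⁻¹ ⟩
  0ℚ               ∎)
  where
  instance
    p≢0′ : ℚ.NonZero p
    p≢0′ = ℚ.≢-nonZero p≢0
  p⁻¹ : ℚ
  p⁻¹ = ℚ.1/ p

sumFin-cong : ∀ n {f g : Fin n → ℚ} → (∀ i → f i ≡ g i) → sumFin n f ≡ sumFin n g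
sumFin-cong zero eq = refl
sumFin-cong (suc n) eq = cong₂ _+q_ (eq Fin.zero) (sumFin-cong n (λ i → eq (Fin.suc i)))

sumFin-+ : ∀ n (f g : Fin n → ℚ) → sumFin n (λ i → f i +q g i) ≡ sumFin n f +q sumFin n g
sumFin-+ zero f g = refl
sumFin-+ (suc n) f g = trans (cong (f Fin.zero +q g Fin.zero +q_) (sumFin-+ n _ _))
  (solve 4 (λ a b c d → (a :+ b) :+ (c :+ d) := (a :+ c) :+ (b :+ d)) refl (f Fin.zero) (g Fin.zero) (sumFin n (λ i → f (Fin.suc i))) (sumFin n (λ i → g (Fin.suc i))))
  where open +-*-Solver

sumFin-* : ∀ n a (f : Fin n → ℚ) → sumFin n (λ i → a *q f i) ≡ a *q sumFin n f
sumFin-* zero a f = sym (ℚP.*-zeroʳ a)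
sumFin-* (suc n) a f = trans (cong (a *q f Fin.zero +q_) (sumFin-* n a _)) (sym (ℚP.*-distribˡ-+ a _ _))

sumFin-0 : ∀ n → sumFin n (λ _ → 0ℚ) ≡ 0ℚ
sumFin-0 zero = refl
sumFin-0 (suc n) = trans (ℚP.+-identityˡ _) (sumFin-0 n)

single : ∀ {n} → Fin n → ℚ → Fin n → ℚ
single Fin.zero v Fin.zero = v
single Fin.zero v (Fin.suc i) = 0ℚ
single (Fin.suc a) v Fin.zero = 0ℚ
single (Fin.suc a) v (Fin.suc i) = single a v i

single-self : ∀ {n} (a : Fin n) v → single a v a ≡ v
single-self Fin.zero v = refl
single-self (Fin.suc a) v = single-self a v

single-other : ∀ {n} (a i : Fin n) v → i ≢ a → single a v i ≡ 0ℚ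
single-other Fin.zero Fin.zero v ne = ⊥-elim (ne refl)
single-other Fin.zero (Fin.suc i) v ne = refl
single-other (Fin.suc a) Fin.zero v ne = refl
single-other (Fin.suc a) (Fin.suc i) v ne = single-other a i v (λ eq → ne (cong Fin.suc eq))

sumFin-single : ∀ n (a : Fin n) v → sumFin n (single a v) ≡ v
sumFin-single (suc n) Fin.zero v = trans (cong (v +q_) (sumFin-0 n)) (ℚP.+-identityʳ v)
sumFin-single (suc n) (Fin.suc a) v = trans (ℚP.+-identityˡ _) (sumFin-single n a v)

single-nonNeg : ∀ {n} (a i : Fin n) {v} → 0ℚ ℚ.≤ v → 0ℚ ℚ.≤ single a v i
single-nonNeg Fin.zero Fin.zero h = h
single-nonNeg Fin.zero (Fin.suc i) h = ℚP.≤-refl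
single-nonNeg (Fin.suc a) Fin.zero h = ℚP.≤-refl
single-nonNeg (Fin.suc a) (Fin.suc i) h = single-nonNeg a i h

single-* : ∀ {n} (a i : Fin n) v w → single a v i *q w ≡ single a (v *q w) i
single-* Fin.zero Fin.zero v w = refl
single-* Fin.zero (Fin.suc i) v w = ℚP.*-zeroˡ w
single-* (Fin.suc a) Fin.zero v w = ℚP.*-zeroˡ w
single-* (Fin.suc a) (Fin.suc i) v w = single-* a i v w

single-*-pointwise : ∀ {n} (a : Fin n) (f : Fin n → ℚ) v i → single a v i *q f i ≡ single a (v *q f a) i
single-*-pointwise a f v i with i FinP.≟ a
... | yes refl = trans (single-* a a v (f a)) refl
... | no ne = trans (cong (_*q f i) (single-other a i v ne)) (trans (ℚP.*-zeroˡ (f i)) (sym (single-other a i _ ne)))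

sumFin-mono : ∀ n {f g : Fin n → ℚ} → (∀ i → f i ℚ.≤ g i) → sumFin n f ℚ.≤ sumFin n g
sumFin-mono zero h = ℚP.≤-refl
sumFin-mono (suc n) h = ℚP.+-mono-≤ (h Fin.zero) (sumFin-mono n (λ i → h (Fin.suc i)))

sumFin-nonNeg : ∀ n {f : Fin n → ℚ} → (∀ i → 0ℚ ℚ.≤ f i) → 0ℚ ℚ.≤ sumFin n f
sumFin-nonNeg n h = ≤-respˡ-≡ (sym (sumFin-0 n)) (sumFin-mono n h)

sumFin≡0⇒≡0 : ∀ n {f : Fin n → ℚ} → (∀ i → 0ℚ ℚ.≤ f i) → sumFin n f ≡ 0ℚ → ∀ i → f i ≡ 0ℚ
sumFin≡0⇒≡0 (suc n) h eq Fin.zero = proj₁ (nonNeg+nonNeg≡0 (h Fin.zero) (sumFin-nonNeg n (λ i → h (Fin.suc i))) eq)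
sumFin≡0⇒≡0 (suc n) h eq (Fin.suc i) = sumFin≡0⇒≡0 n (λ j → h (Fin.suc j)) (proj₂ (nonNeg+nonNeg≡0 (h Fin.zero) (sumFin-nonNeg n (λ i → h (Fin.suc i))) eq)) i

elt∈hull : ∀ {d} (B : FinSet (Zd d)) (i : Fin (size B)) → InHull B (elt B i)
elt∈hull B i = single i 1ℚ , (λ j → single-nonNeg i j (ℚP.nonNegative⁻¹ 1ℚ)) , sumFin-single (size B) i 1ℚ ,
  λ r → trans (sumFin-cong (size B) (λ j → single-*-pointwise i (λ j → toℚ (lookup (elt B j) r)) 1ℚ j))
        (trans (sumFin-single (size B) i _) (ℚP.*-identityˡ _))

sumFin-neg : ∀ n (f : Fin n → ℚ) → sumFin n (λ i → ℚ.- f i) ≡ ℚ.- sumFin n f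
sumFin-neg zero f = refl
sumFin-neg (suc n) f = trans (cong (ℚ.- f Fin.zero +q_) (sumFin-neg n _)) (sym (ℚP.neg-distrib-+ (f Fin.zero) _))

module HullBounds {d} (B : FinSet (Zd d)) (x : Zd d) (h : InHull B x) where
  λ' : Fin (size B) → ℚ
  λ' = proj₁ h
  nn : ∀ i → 0ℚ ℚ.≤ λ' i
  nn = proj₁ (proj₂ h)
  s1 : sumFin (size B) λ' ≡ 1ℚ
  s1 = proj₁ (proj₂ (proj₂ h))
  co : ∀ r → sumFin (size B) (λ i → λ' i *q ι (lookup (elt B i) r)) ≡ ι (lookup x r)
  co r = trans (sumFin-cong (size B) (λ i → cong (λ q → λ' i *q q) (sym (toℚ≡ι _))))
               (trans (proj₂ (proj₂ (proj₂ h)) r) (toℚ≡ι _))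

  const-sum : ∀ c → sumFin (size B) (λ i → λ' i *q c) ≡ c
  const-sum c = trans (sumFin-cong (size B) (λ i → ℚP.*-comm (λ' i) c))
                 (trans (sumFin-* (size B) c λ') (trans (cong (c *q_) s1) (ℚP.*-identityʳ c)))

  hull-le : ∀ r M → (∀ i → λ' i ≡ 0ℚ ⊎ lookup (elt B i) r ℤ.≤ M) → lookup x r ℤ.≤ M
  hull-le r M hyp = ι-≤⁻ (≤-respˡ-≡ (sym (co r)) (≤-respʳ-≡ (sumFin-mono (size B) pt) (const-sum (ι M))))
    where
    pt : ∀ i → λ' i *q ι (lookup (elt B i) r) ℚ.≤ λ' i *q ι M
    pt i with hyp i
    ... | inj₁ z = ≤-respˡ-≡ (trans (cong (_*q ι (lookup (elt B i) r)) z) (ℚP.*-zeroˡ (ι (lookup (elt B i) r))))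
                     (≤-respʳ-≡ ℚP.≤-refl (sym (trans (cong (_*q ι M) z) (ℚP.*-zeroˡ (ι M)))))
    ... | inj₂ le = *-monoˡ-≤-0≤ (nn i) (ι-≤ le)

  hull-ge : ∀ r m → (∀ i → λ' i ≡ 0ℚ ⊎ m ℤ.≤ lookup (elt B i) r) → m ℤ.≤ lookup x r
  hull-ge r m hyp = ι-≤⁻ (≤-respˡ-≡ (sym (const-sum (ι m))) (≤-respʳ-≡ (sumFin-mono (size B) pt) (co r)))
    where
    pt : ∀ i → λ' i *q ι m ℚ.≤ λ' i *q ι (lookup (elt B i) r)
    pt i with hyp i
    ... | inj₁ z = ≤-respˡ-≡ (trans (cong (_*q ι m) z) (ℚP.*-zeroˡ (ι m)))
                     (≤-respʳ-≡ ℚP.≤-refl (sym (trans (cong (_*q ι (lookup (elt B i) r)) z) (ℚP.*-zeroˡ (ι (lookup (elt B i) r))))))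
    ... | inj₂ le = *-monoˡ-≤-0≤ (nn i) (ι-≤ le)

  zero-terms : ∀ (g : Fin (size B) → ℤ) → (∀ i → + 0 ℤ.≤ g i) →
               sumFin (size B) (λ i → λ' i *q ι (g i)) ≡ 0ℚ → ∀ i → λ' i ≡ 0ℚ ⊎ g i ≡ + 0
  zero-terms g gnn eq i with *≡0⇒≡0⊎≡0 (λ' i) (ι (g i)) (sumFin≡0⇒≡0 (size B) (λ j → nonNeg*nonNeg (nn j) (ι-≤ (gnn j))) eq i)
  ... | inj₁ z = inj₁ z
  ... | inj₂ z = inj₂ (ι-inj z)

  tight-low : ∀ r m → (∀ i → m ℤ.≤ lookup (elt B i) r) → lookup x r ≡ m → ∀ i → λ' i ≡ 0ℚ ⊎ lookup (elt B i) r ≡ m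
  tight-low r m hyp eq i with zero-terms (λ j → lookup (elt B j) r ℤ.- m) (λ j → ℤP.i≤j⇒0≤j-i (hyp j)) sumz i
    where
    distrib : ∀ l a b → l *q (a +q ℚ.- b) ≡ l *q a +q ℚ.- (b *q l)
    distrib l a b = trans (ℚP.*-distribˡ-+ l a (ℚ.- b)) (cong (l *q a +q_) (trans (sym (ℚP.neg-distribʳ-* l b)) (cong ℚ.-_ (ℚP.*-comm l b))))
    sumz : sumFin (size B) (λ j → λ' j *q ι (lookup (elt B j) r ℤ.- m)) ≡ 0ℚ
    sumz = begin
      sumFin (size B) (λ j → λ' j *q ι (lookup (elt B j) r ℤ.- m))
        ≡⟨ sumFin-cong (size B) (λ j → trans (cong (λ q → λ' j *q q) (sym (trans (cong (ι (lookup (elt B j) r) +q_) (ι-neg m)) (ι-+ (lookup (elt B j) r) (ℤ.- m)))))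
              (distrib (λ' j) (ι (lookup (elt B j) r)) (ι m))) ⟩
      sumFin (size B) (λ j → λ' j *q ι (lookup (elt B j) r) +q ℚ.- (ι m *q λ' j))
        ≡⟨ sumFin-+ (size B) (λ j → λ' j *q ι (lookup (elt B j) r)) (λ j → ℚ.- (ι m *q λ' j)) ⟩
      sumFin (size B) (λ j → λ' j *q ι (lookup (elt B j) r)) +q sumFin (size B) (λ j → ℚ.- (ι m *q λ' j))
        ≡⟨ cong₂ _+q_ (co r) (trans (sumFin-neg (size B) (λ j → ι m *q λ' j)) (cong ℚ.-_ (trans (sumFin-* (size B) (ι m) λ') (trans (cong (ι m *q_) s1) (ℚP.*-identityʳ (ι m)))))) ⟩
      ι (lookup x r) +q ℚ.- ι m
        ≡⟨ cong (λ z → ι z +q ℚ.- ι m) eq ⟩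
      ι m +q ℚ.- ι m
        ≡⟨ ℚP.+-inverseʳ (ι m) ⟩
      0ℚ ∎
  ... | inj₁ z = inj₁ z
  ... | inj₂ z = inj₂ (ℤP.i-j≡0⇒i≡j _ _ z)

  tight-up : ∀ r M → (∀ i → lookup (elt B i) r ℤ.≤ M) → lookup x r ≡ M → ∀ i → λ' i ≡ 0ℚ ⊎ lookup (elt B i) r ≡ M
  tight-up r M hyp eq i with zero-terms (λ j → M ℤ.- lookup (elt B j) r) (λ j → ℤP.i≤j⇒0≤j-i (hyp j)) sumz i
    where
    distrib : ∀ l a b → l *q (b +q ℚ.- a) ≡ b *q l +q ℚ.- (l *q a)
    distrib l a b = trans (ℚP.*-distribˡ-+ l b (ℚ.- a)) (cong₂ _+q_ (ℚP.*-comm l b) (sym (ℚP.neg-distribʳ-* l a)))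
    sumz : sumFin (size B) (λ j → λ' j *q ι (M ℤ.- lookup (elt B j) r)) ≡ 0ℚ
    sumz = begin
      sumFin (size B) (λ j → λ' j *q ι (M ℤ.- lookup (elt B j) r))
        ≡⟨ sumFin-cong (size B) (λ j → trans (cong (λ q → λ' j *q q) (sym (trans (cong (ι M +q_) (ι-neg (lookup (elt B j) r))) (ι-+ M (ℤ.- lookup (elt B j) r)))))
              (distrib (λ' j) (ι (lookup (elt B j) r)) (ι M))) ⟩
      sumFin (size B) (λ j → ι M *q λ' j +q ℚ.- (λ' j *q ι (lookup (elt B j) r)))
        ≡⟨ sumFin-+ (size B) (λ j → ι M *q λ' j) (λ j → ℚ.- (λ' j *q ι (lookup (elt B j) r))) ⟩
      sumFin (size B) (λ j → ι M *q λ' j) +q sumFin (size B) (λ j → ℚ.- (λ' j *q ι (lookup (elt B j) r)))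
        ≡⟨ cong₂ _+q_ (trans (sumFin-* (size B) (ι M) λ') (trans (cong (ι M *q_) s1) (ℚP.*-identityʳ (ι M)))) (trans (sumFin-neg (size B) (λ j → λ' j *q ι (lookup (elt B j) r))) (cong ℚ.-_ (co r))) ⟩
      ι M +q ℚ.- ι (lookup x r)
        ≡⟨ cong (λ z → ι M +q ℚ.- ι z) eq ⟩
      ι M +q ℚ.- ι M
        ≡⟨ ℚP.+-inverseʳ (ι M) ⟩
      0ℚ ∎
  ... | inj₁ z = inj₁ z
  ... | inj₂ z = inj₂ (sym (ℤP.i-j≡0⇒i≡j _ _ z))

module HullSegment (N' : ℕ) where
  ιN : ℚ
  ιN = ι (+ suc N')
  instance
    nzN : ℚ.NonZero ιN
    nzN = ℚ.≢-nonZero {ιN} (λ ())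
  rr : ℚ
  rr = ℚ.1/ ιN
  0≤rr : 0ℚ ℚ.≤ rr
  0≤rr = ℚP.nonNegative⁻¹ rr {{ℚP.pos⇒nonNeg rr {{ℚP.1/pos⇒pos ιN}}}}

  between-in-hull : (B : FinSet (Zd 1)) (a b : Fin (size B)) → a ≢ b → ∀ P Q E →
           elt B a ≡ P ∷ [] → elt B b ≡ Q ∷ [] → ∀ s t → s + t ≡ suc N' →
           Q ≡ P ℤ.+ + suc N' ℤ.* E → InHull B ((P ℤ.+ + t ℤ.* E) ∷ [])
  between-in-hull B a b a≢b P Q E ea eb s t st eQ = lam , nnl , sum1 , coord
    where
    α β : ℚ
    α = ι (+ s) *q rr
    β = ι (+ t) *q rr
    lam : Fin (size B) → ℚ
    lam j = single a α j +q single b β j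
    nnl : ∀ j → 0ℚ ℚ.≤ lam j
    nnl j = ≤-respˡ-≡ (sym (ℚP.+-identityˡ 0ℚ)) (ℚP.+-mono-≤ (single-nonNeg a j {α} (nonNeg*nonNeg (ι-≤ {+ 0} {+ s} (ℤ.+≤+ z≤n)) 0≤rr))
                                                         (single-nonNeg b j {β} (nonNeg*nonNeg (ι-≤ {+ 0} {+ t} (ℤ.+≤+ z≤n)) 0≤rr)))
    st' : ι (+ s) +q ι (+ t) ≡ ιN
    st' = trans (ι-+ (+ s) (+ t)) (cong (λ z → ι (+ z)) st)
    sum1 : sumFin (size B) lam ≡ 1ℚ
    sum1 = begin
      sumFin (size B) lam ≡⟨ sumFin-+ (size B) (single a α) (single b β) ⟩
      sumFin (size B) (single a α) +q sumFin (size B) (single b β) ≡⟨ cong₂ _+q_ (sumFin-single (size B) a α) (sumFin-single (size B) b β) ⟩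
      α +q β ≡⟨ sym (ℚP.*-distribʳ-+ rr (ι (+ s)) (ι (+ t))) ⟩
      (ι (+ s) +q ι (+ t)) *q rr ≡⟨ cong (_*q rr) st' ⟩
      ιN *q rr ≡⟨ ℚP.*-inverseʳ ιN ⟩
      1ℚ ∎
    f : Fin (size B) → ℚ
    f j = toℚ (Vec.lookup (elt B j) Fin.zero)
    fa : f a ≡ ι P
    fa = trans (cong (λ v → toℚ (Vec.lookup v Fin.zero)) ea) (toℚ≡ι P)
    fb : f b ≡ ι Q
    fb = trans (cong (λ v → toℚ (Vec.lookup v Fin.zero)) eb) (toℚ≡ι Q)
    coord : ∀ (r : Fin 1) → sumFin (size B) (λ j → lam j *q toℚ (Vec.lookup (elt B j) r)) ≡ toℚ (Vec.lookup ((P ℤ.+ + t ℤ.* E) ∷ []) r)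
    coord Fin.zero = begin
      sumFin (size B) (λ j → lam j *q f j)
        ≡⟨ sumFin-cong (size B) (λ j → trans (ℚP.*-distribʳ-+ (f j) (single a α j) (single b β j))
              (cong₂ _+q_ (single-*-pointwise a f α j) (single-*-pointwise b f β j))) ⟩
      sumFin (size B) (λ j → single a (α *q f a) j +q single b (β *q f b) j)
        ≡⟨ sumFin-+ (size B) (single a (α *q f a)) (single b (β *q f b)) ⟩
      sumFin (size B) (single a (α *q f a)) +q sumFin (size B) (single b (β *q f b))
        ≡⟨ cong₂ _+q_ (sumFin-single (size B) a (α *q f a)) (sumFin-single (size B) b (β *q f b)) ⟩
      α *q f a +q β *q f b
        ≡⟨ cong₂ (λ u v → α *q u +q β *q v) fa (trans fb (trans (cong ι eQ) (sym (trans (cong (ι P +q_) (ι-* (+ suc N') E)) (ι-+ P (+ suc N' ℤ.* E)))))) ⟩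
      α *q ι P +q β *q (ι P +q ιN *q ι E)
        ≡⟨ weighted-average (ι (+ s)) (ι (+ t)) ιN rr (ι P) (ι E) st' (ℚP.*-inverseʳ ιN) ⟩
      ι P +q ι (+ t) *q ι E
        ≡⟨ trans (cong (ι P +q_) (ι-* (+ t) E)) (ι-+ P (+ t ℤ.* E)) ⟩
      ι (P ℤ.+ + t ℤ.* E)
        ≡⟨ sym (toℚ≡ι _) ⟩
      toℚ (P ℤ.+ + t ℤ.* E) ∎
      where
      weighted-average : ∀ s t n r p e → s +q t ≡ n → n *q r ≡ 1ℚ →
                         s *q r *q p +q t *q r *q (p +q n *q e) ≡ p +q t *q e
      weighted-average s t n r p e s+t≡n n*r≡1 = begin
        s *q r *q p +q t *q r *q (p +q n *q e)    ≡⟨ +-*-Solver.solve 6 (λ s t n r p e →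
                                                        s :* r :* p :+ t :* r :* (p :+ n :* e) :=
                                                        (s :+ t) :* r :* p :+ t :* (n :* r) :* e) refl s t n r p e ⟩
        (s +q t) *q r *q p +q t *q (n *q r) *q e  ≡⟨ cong (λ z → z *q r *q p +q t *q (n *q r) *q e) s+t≡n ⟩
        n *q r *q p +q t *q (n *q r) *q e         ≡⟨ cong (λ z → z *q p +q t *q z *q e) n*r≡1 ⟩
        1ℚ *q p +q t *q 1ℚ *q e                   ≡⟨ cong₂ _+q_ (ℚP.*-identityˡ p) (cong (_*q e) (ℚP.*-identityʳ t)) ⟩
        p +q t *q e                               ∎
        where open +-*-Solver using (_:*_; _:+_; _:=_)

-- Maps preserving additive quadruples

PreservesSumsOn : (ℕ → Set) → (ℕ → ℤ) → Set
PreservesSumsOn S G = ∀ {a b c d} → S a → S b → S c → S d → a + b ≡ c + d → G a ℤ.+ G b ≡ G c ℤ.+ G d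

x+y≡z⇒y≡z-x : ∀ x y z → x ℤ.+ y ≡ z → y ≡ z ℤ.- x
x+y≡z⇒y≡z-x x y z eq = trans (rearrange x y) (cong (ℤ._- x) eq)
  where
  rearrange : ∀ x y → y ≡ x ℤ.+ y ℤ.- x
  rearrange = solveℤ

x+y≡z⇒x≡z-y : ∀ x y z → x ℤ.+ y ≡ z → x ≡ z ℤ.- y
x+y≡z⇒x≡z-y x y z eq = trans (rearrange x y) (cong (ℤ._- y) eq)
  where
  rearrange : ∀ x y → x ≡ x ℤ.+ y ℤ.- y
  rearrange = solveℤ

i≡i+0*j : ∀ i j → i ≡ i ℤ.+ + 0 ℤ.* j
i≡i+0*j = solveℤ

module ArithmeticProgression (G : ℕ → ℤ) (s n : ℕ)
          (rel : ∀ j → suc (suc j) < n → G (s + j) ℤ.+ G (s + suc (suc j)) ≡ G (s + suc j) ℤ.+ G (s + suc j)) where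
  B D : ℤ
  B = G (s + 0)
  D = G (s + 1) ℤ.- G (s + 0)

  both : ∀ j → suc j < n → (G (s + j) ≡ B ℤ.+ + j ℤ.* D) × (G (s + suc j) ≡ B ℤ.+ + suc j ℤ.* D)
  both zero _ = i≡i+0*j B D , step₁ B (G (s + 1))
    where
    step₁ : ∀ B X → X ≡ B ℤ.+ + 1 ℤ.* (X ℤ.- B)
    step₁ = solveℤ
  both (suc j) lt with both j (ℕP.<-trans (ℕP.n<1+n (suc j)) lt)
  ... | h0 , h1 = h1 , trans (x+y≡z⇒y≡z-x (G (s + j)) _ _ (rel j lt))
                       (trans (cong₂ (λ u v → u ℤ.+ u ℤ.- v) h1 h0) (step B D (+ j)))
    where
    step : ∀ B D J → (B ℤ.+ (+ 1 ℤ.+ J) ℤ.* D) ℤ.+ (B ℤ.+ (+ 1 ℤ.+ J) ℤ.* D) ℤ.- (B ℤ.+ J ℤ.* D) ≡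
                     B ℤ.+ (+ 1 ℤ.+ (+ 1 ℤ.+ J)) ℤ.* D
    step = solveℤ

  ap : ∀ j → j < n → G (s + j) ≡ B ℤ.+ + j ℤ.* D
  ap zero lt = i≡i+0*j B D
  ap (suc j) lt = proj₂ (both j lt)

module Rigidity (k1 c k2 : ℕ) (G : ℕ → ℤ) (rel : PreservesSumsOn (InTwoSeg k1 c k2) G) where
  s2 : ℕ
  s2 = k1 + c

  inS1 : ∀ {x} → x < k1 → InTwoSeg k1 c k2 x
  inS1 lt = inj₁ (z≤n , lt)
  inS2 : ∀ {j} → j < k2 → InTwoSeg k1 c k2 (s2 + j)
  inS2 {j} lt = inj₂ (ℕP.m≤m+n s2 j , ℕP.+-monoʳ-< s2 lt)

  middle : ∀ s j → s + j + (s + suc (suc j)) ≡ s + suc j + (s + suc j)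
  middle = solveℕ

  lt-up : ∀ {j n} → suc (suc j) < n → j < n
  lt-up lt = ℕP.<-trans (ℕP.n<1+n _) (ℕP.<-trans (ℕP.n<1+n _) lt)
  lt-up1 : ∀ {j n} → suc (suc j) < n → suc j < n
  lt-up1 lt = ℕP.<-trans (ℕP.n<1+n _) lt

  module AP2 = ArithmeticProgression G s2 k2 (λ j lt → rel (inS2 (lt-up lt)) (inS2 lt) (inS2 (lt-up1 lt)) (inS2 (lt-up1 lt)) (middle s2 j))
  module AP1 = ArithmeticProgression G 0 k1 (λ j lt → rel (inS1 (lt-up lt)) (inS1 lt) (inS1 (lt-up1 lt)) (inS1 (lt-up1 lt)) (middle 0 j))

  same-diff : 1 < k1 → 1 < k2 → AP1.D ≡ AP2.D
  same-diff h1 h2 = swap-differences (G 0) (G (s2 + 0)) (G (s2 + 1)) (G 1)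
    (rel (inS1 (ℕP.<-trans (ℕP.n<1+n 0) h1)) (inS2 h2) (inS1 h1) (inS2 (ℕP.<-trans (ℕP.n<1+n 0) h2))
         (ℕP.+-suc s2 0))
    where
    swap-differences : ∀ a b x y → a ℤ.+ x ≡ y ℤ.+ b → y ℤ.- a ≡ x ℤ.- b
    swap-differences a b x y eq = trans (rearrange₁ a b y) (trans (cong (λ z → z ℤ.- a ℤ.- b) (sym eq)) (rearrange₂ a b x))
      where
      rearrange₁ : ∀ a b y → y ℤ.- a ≡ y ℤ.+ b ℤ.- a ℤ.- b
      rearrange₁ = solveℤ
      rearrange₂ : ∀ a b x → a ℤ.+ x ℤ.- a ℤ.- b ≡ x ℤ.- b
      rearrange₂ = solveℤ

module RigidityLongSecond (a1 c e : ℕ) (G : ℕ → ℤ) (rel : PreservesSumsOn (InTwoSeg (suc a1) c (suc (suc (c + e)))) G) where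
  open Rigidity (suc a1) c (suc (suc (c + e))) G rel public
  a2 : ℕ
  a2 = suc (c + e)
  B D : ℤ
  B = AP2.B
  D = AP2.D

  -- Here a₂ = 1 + c + e (the second segment is longer than the gap) is used:
  -- a₁ + (s₂ + a₂) = s₂ + (s₂ + e) relates the first segment to the second one.
  last-of-first : G a1 ℤ.+ G (s2 + a2) ≡ G (s2 + 0) ℤ.+ G (s2 + e)
  last-of-first = rel (inS1 (ℕP.n<1+n a1)) (inS2 (ℕP.n<1+n a2)) (inS2 (s≤s z≤n))
           (inS2 (s≤s (ℕP.m≤n⇒m≤1+n (ℕP.m≤n+m e c)))) (quadruple a1 c e)
    where
    quadruple : ∀ a1 c e → a1 + (suc a1 + c + suc (c + e)) ≡ suc a1 + c + 0 + (suc a1 + c + e)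
    quadruple = solveℕ

  G[a₁]+[1+c]D≡B : G a1 ℤ.+ (+ 1 ℤ.+ + c) ℤ.* D ≡ B
  G[a₁]+[1+c]D≡B = trans (cong (λ z → z ℤ.+ (+ 1 ℤ.+ + c) ℤ.* D)
                 (trans (x+y≡z⇒x≡z-y (G a1) (G (s2 + a2)) _ last-of-first)
                        (cong₂ (λ u v → B ℤ.+ u ℤ.- v) (AP2.ap e (s≤s (ℕP.m≤n⇒m≤1+n (ℕP.m≤n+m e c))))
                                                      (AP2.ap a2 (ℕP.n<1+n a2)))))
              (simplify B D (+ c) (+ e))
    where
    simplify : ∀ B D C E → B ℤ.+ (B ℤ.+ E ℤ.* D) ℤ.- (B ℤ.+ (+ 1 ℤ.+ (C ℤ.+ E)) ℤ.* D) ℤ.+ (+ 1 ℤ.+ C) ℤ.* D ≡ B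
    simplify = solveℤ

  affine-at-a₁ : G a1 ℤ.+ + s2 ℤ.* D ≡ B ℤ.+ + a1 ℤ.* D
  affine-at-a₁ = trans (rearrange (G a1) (+ a1) (+ c) D) (cong (λ z → z ℤ.+ + a1 ℤ.* D) G[a₁]+[1+c]D≡B)
    where
    rearrange : ∀ X A1 C D → X ℤ.+ (+ 1 ℤ.+ (A1 ℤ.+ C)) ℤ.* D ≡ X ℤ.+ (+ 1 ℤ.+ C) ℤ.* D ℤ.+ A1 ℤ.* D
    rearrange = solveℤ

  affine-shifted : ∀ m → InTwoSeg (suc a1) c (suc a2) m → G m ℤ.+ + s2 ℤ.* D ≡ B ℤ.+ + m ℤ.* D
  affine-shifted m (inj₂ (lo , hi)) with ℕP.m≤n⇒∃[o]m+o≡n lo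
  ... | j , refl = trans (cong (λ z → z ℤ.+ + s2 ℤ.* D) (AP2.ap j (ℕP.+-cancelˡ-< s2 j (suc a2) hi)))
                        (collect B D (+ s2) (+ j))
    where
    collect : ∀ B D S J → B ℤ.+ J ℤ.* D ℤ.+ S ℤ.* D ≡ B ℤ.+ (S ℤ.+ J) ℤ.* D
    collect = solveℤ
  affine-shifted m (inj₁ (_ , lt)) with 1 ℕ.<? suc a1
  ... | no n1 = subst (λ z → G z ℤ.+ + s2 ℤ.* D ≡ B ℤ.+ + z ℤ.* D) (sym m≡a1) affine-at-a₁
    where
    a1≡0 : a1 ≡ 0
    a1≡0 = ℕP.n≤0⇒n≡0 (ℕP.≤-pred (ℕP.≮⇒≥ n1))
    m≡a1 : m ≡ a1
    m≡a1 = trans (ℕP.n≤0⇒n≡0 (subst (m ≤_) a1≡0 (ℕP.≤-pred lt))) (sym a1≡0)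
  ... | yes h1 = trans (cong (λ z → z ℤ.+ + s2 ℤ.* D) (trans (AP1.ap m lt) (cong (λ z → G 0 ℤ.+ + m ℤ.* z) sd)))
                        (trans (rearrange (G 0) (+ m) (+ a1) (+ c) D)
                          (cong (λ z → z ℤ.+ + m ℤ.* D) (trans (cong (λ z → z ℤ.+ (+ 1 ℤ.+ + c) ℤ.* D)
                             (sym (trans (AP1.ap a1 (ℕP.n<1+n _)) (cong (λ z → G 0 ℤ.+ + a1 ℤ.* z) sd)))) G[a₁]+[1+c]D≡B)))
    where
    sd : AP1.D ≡ D
    sd = same-diff h1 (s≤s (s≤s z≤n))
    rearrange : ∀ G0 M A1 C D → G0 ℤ.+ M ℤ.* D ℤ.+ (+ 1 ℤ.+ (A1 ℤ.+ C)) ℤ.* D ≡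
                                (G0 ℤ.+ A1 ℤ.* D ℤ.+ (+ 1 ℤ.+ C) ℤ.* D) ℤ.+ M ℤ.* D
    rearrange = solveℤ

module RigidityShort (k1 c k2 : ℕ) (G : ℕ → ℤ) (rel : PreservesSumsOn (InTwoSeg k1 c k2) G) where
  open Rigidity k1 c k2 G rel public

  small : ∀ {n j} → ¬ (1 < n) → j < n → j ≡ 0
  small n1 lt = ℕP.n≤0⇒n≡0 (ℕP.≤-pred (ℕP.≤-trans lt (ℕP.≮⇒≥ n1)))

  affine : Σ ℤ λ D → (∀ m → m < k1 → G m ≡ G 0 ℤ.+ + m ℤ.* D) ×
                   (∀ j → j < k2 → G (s2 + j) ≡ G (s2 + 0) ℤ.+ + j ℤ.* D)
  affine with 1 ℕ.<? k1 | 1 ℕ.<? k2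
  ... | yes h1 | yes h2 = AP1.D , AP1.ap , λ j lt → trans (AP2.ap j lt) (cong (λ z → G (s2 + 0) ℤ.+ + j ℤ.* z) (sym (same-diff h1 h2)))
  ... | yes h1 | no n2 = AP1.D , AP1.ap , λ j lt → subst (λ j → G (s2 + j) ≡ G (s2 + 0) ℤ.+ + j ℤ.* AP1.D) (sym (small n2 lt)) (i≡i+0*j (G (s2 + 0)) AP1.D)
  ... | no n1 | _ = AP2.D , (λ m lt → subst (λ m → G m ≡ G 0 ℤ.+ + m ℤ.* AP2.D) (sym (small n1 lt)) (i≡i+0*j (G 0) AP2.D)) , AP2.ap

vec-ext : ∀ {d} (u v : Zd d) → (∀ r → lookup u r ≡ lookup v r) → u ≡ v
vec-ext [] [] h = refl
vec-ext (x ∷ u) (y ∷ v) h = cong₂ _∷_ (h Fin.zero) (vec-ext u v (λ r → h (Fin.suc r)))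

lookup-+ᵛ : ∀ {d} (u v : Zd d) r → lookup (u +ᵛ v) r ≡ lookup u r ℤ.+ lookup v r
lookup-+ᵛ (x ∷ u) (y ∷ v) Fin.zero = refl
lookup-+ᵛ (x ∷ u) (y ∷ v) (Fin.suc r) = lookup-+ᵛ u v r

dot-0ᵛ : ∀ {d} (v : Zd d) → dot 0ᵛ v ≡ + 0
dot-0ᵛ [] = refl
dot-0ᵛ (x ∷ v) = trans (cong (ℤ._+_ (+ 0 ℤ.* x)) (dot-0ᵛ v)) (ℤP.+-identityʳ (+ 0 ℤ.* x))

dot-affine : ∀ {d} (c v P E : Zd d) (a : ℤ) → (∀ r → lookup v r ≡ lookup P r ℤ.+ a ℤ.* lookup E r) →
             dot c v ≡ dot c P ℤ.+ a ℤ.* dot c E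
dot-affine [] [] [] [] a h = zero-case a
  where
  zero-case : ∀ a → + 0 ≡ + 0 ℤ.+ a ℤ.* + 0
  zero-case = solveℤ
dot-affine (c0 ∷ c) (v0 ∷ v) (P0 ∷ P) (E0 ∷ E) a h =
  trans (cong₂ (λ u w → c0 ℤ.* u ℤ.+ w) (h Fin.zero) (dot-affine c v P E a (λ r → h (Fin.suc r))))
        (distrib c0 P0 E0 a (dot c P) (dot c E))
  where
  distrib : ∀ c0 P0 E0 a X Y → c0 ℤ.* (P0 ℤ.+ a ℤ.* E0) ℤ.+ (X ℤ.+ a ℤ.* Y) ≡
                               (c0 ℤ.* P0 ℤ.+ X) ℤ.+ a ℤ.* (c0 ℤ.* E0 ℤ.+ Y)
  distrib = solveℤ

orthogonal₁ : ∀ {d} (E : Zd (suc (suc d))) → Σ (Zd (suc (suc d))) λ c → c ≢ 0ᵛ × dot c E ≡ + 0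
orthogonal₁ {d} (e1 ∷ e2 ∷ E) with e1 ℤ.≟ + 0
... | yes refl = (+ 1 ∷ + 0 ∷ 0ᵛ) , (λ eq → case1 (VecP.∷-injectiveˡ eq)) ,
      trans (cong (λ z → + 1 ℤ.* + 0 ℤ.+ (+ 0 ℤ.* e2 ℤ.+ z)) (dot-0ᵛ E)) (p1 e2)
  where
  case1 : + 1 ≢ + 0
  case1 ()
  p1 : ∀ e2 → + 1 ℤ.* + 0 ℤ.+ (+ 0 ℤ.* e2 ℤ.+ + 0) ≡ + 0
  p1 = solveℤ
... | no ne = (e2 ∷ ℤ.- e1 ∷ 0ᵛ) , (λ eq → ne (trans (sym (ℤP.neg-involutive e1)) (cong ℤ.-_ (VecP.∷-injectiveˡ (VecP.∷-injectiveʳ eq))))) ,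
      trans (cong (λ z → e2 ℤ.* e1 ℤ.+ (ℤ.- e1 ℤ.* e2 ℤ.+ z)) (dot-0ᵛ E)) (p2 e1 e2)
  where
  p2 : ∀ e1 e2 → e2 ℤ.* e1 ℤ.+ (ℤ.- e1 ℤ.* e2 ℤ.+ + 0) ≡ + 0
  p2 = solveℤ

vec₃ : ∀ {d} → ℤ → ℤ → ℤ → Zd (suc (suc (suc d)))
vec₃ a b c = a ∷ b ∷ c ∷ 0ᵛ

vec₃≢0ᵛ : ∀ {d} a b c → ¬ (a ≡ + 0 × b ≡ + 0 × c ≡ + 0) → vec₃ {d} a b c ≢ 0ᵛ
vec₃≢0ᵛ a b c ne eq = ne (VecP.∷-injectiveˡ eq , VecP.∷-injectiveˡ (VecP.∷-injectiveʳ eq) ,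
                         VecP.∷-injectiveˡ (VecP.∷-injectiveʳ (VecP.∷-injectiveʳ eq)))

dot-vec₃ : ∀ {d} a b c (x1 x2 x3 : ℤ) (X : Zd d) → dot (vec₃ a b c) (x1 ∷ x2 ∷ x3 ∷ X) ≡ a ℤ.* x1 ℤ.+ b ℤ.* x2 ℤ.+ c ℤ.* x3
dot-vec₃ a b c x1 x2 x3 X = trans (cong (λ z → a ℤ.* x1 ℤ.+ (b ℤ.* x2 ℤ.+ (c ℤ.* x3 ℤ.+ z))) (dot-0ᵛ X)) (reassoc a b c x1 x2 x3)
  where
  reassoc : ∀ a b c x1 x2 x3 → a ℤ.* x1 ℤ.+ (b ℤ.* x2 ℤ.+ (c ℤ.* x3 ℤ.+ + 0)) ≡ a ℤ.* x1 ℤ.+ b ℤ.* x2 ℤ.+ c ℤ.* x3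
  reassoc = solveℤ

all-zero? : ∀ a b c → Dec (a ≡ + 0 × b ≡ + 0 × c ≡ + 0)
all-zero? a b c = (a ℤ.≟ + 0) ×-dec ((b ℤ.≟ + 0) ×-dec (c ℤ.≟ + 0))

w·e≡0 : ∀ e1 e2 e3 f1 f2 f3 → (e2 ℤ.* f3 ℤ.- e3 ℤ.* f2) ℤ.* e1 ℤ.+ (e3 ℤ.* f1 ℤ.- e1 ℤ.* f3) ℤ.* e2 ℤ.+ (e1 ℤ.* f2 ℤ.- e2 ℤ.* f1) ℤ.* e3 ≡ + 0
w·e≡0 = solveℤ

w·f≡0 : ∀ e1 e2 e3 f1 f2 f3 → (e2 ℤ.* f3 ℤ.- e3 ℤ.* f2) ℤ.* f1 ℤ.+ (e3 ℤ.* f1 ℤ.- e1 ℤ.* f3) ℤ.* f2 ℤ.+ (e1 ℤ.* f2 ℤ.- e2 ℤ.* f1) ℤ.* f3 ≡ + 0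
w·f≡0 = solveℤ

e×ĵ·e≡0 : ∀ e1 e2 e3 → ℤ.- e3 ℤ.* e1 ℤ.+ + 0 ℤ.* e2 ℤ.+ e1 ℤ.* e3 ≡ + 0
e×ĵ·e≡0 = solveℤ

e×ĵ·f≡-w₂ : ∀ e1 e3 f1 f2 f3 → ℤ.- e3 ℤ.* f1 ℤ.+ + 0 ℤ.* f2 ℤ.+ e1 ℤ.* f3 ≡ ℤ.- (e3 ℤ.* f1 ℤ.- e1 ℤ.* f3)
e×ĵ·f≡-w₂ = solveℤ

f×ĵ·e≡w₂ : ∀ e1 e2 e3 f1 f3 → ℤ.- f3 ℤ.* e1 ℤ.+ + 0 ℤ.* e2 ℤ.+ f1 ℤ.* e3 ≡ e3 ℤ.* f1 ℤ.- e1 ℤ.* f3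
f×ĵ·e≡w₂ = solveℤ

î·e≡e₁ : ∀ e1 e2 e3 → + 1 ℤ.* e1 ℤ.+ + 0 ℤ.* e2 ℤ.+ + 0 ℤ.* e3 ≡ e1
î·e≡e₁ = solveℤ

-- The cross product w = e × f of the first three coordinates, unless it vanishes; then e and f
-- are parallel, and e × ĵ, f × ĵ or î is a nonzero vector orthogonal to both (î, ĵ the first
-- two unit vectors).
orthogonal₂ : ∀ {d} (E F : Zd (suc (suc (suc d)))) →
        Σ (Zd (suc (suc (suc d)))) λ c → c ≢ 0ᵛ × dot c E ≡ + 0 × dot c F ≡ + 0
orthogonal₂ {d} (e1 ∷ e2 ∷ e3 ∷ E) (f1 ∷ f2 ∷ f3 ∷ F)
  with all-zero? (e2 ℤ.* f3 ℤ.- e3 ℤ.* f2) (e3 ℤ.* f1 ℤ.- e1 ℤ.* f3) (e1 ℤ.* f2 ℤ.- e2 ℤ.* f1)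
... | no nz = vec₃ W1 W2 W3 , vec₃≢0ᵛ W1 W2 W3 nz ,
      trans (dot-vec₃ W1 W2 W3 e1 e2 e3 E) (w·e≡0 e1 e2 e3 f1 f2 f3) , trans (dot-vec₃ W1 W2 W3 f1 f2 f3 F) (w·f≡0 e1 e2 e3 f1 f2 f3)
  where
  W1 W2 W3 : ℤ
  W1 = e2 ℤ.* f3 ℤ.- e3 ℤ.* f2
  W2 = e3 ℤ.* f1 ℤ.- e1 ℤ.* f3
  W3 = e1 ℤ.* f2 ℤ.- e2 ℤ.* f1
... | yes (w1 , w2 , w3) with all-zero? (ℤ.- e3) (+ 0) e1
...   | no nz = vec₃ (ℤ.- e3) (+ 0) e1 , vec₃≢0ᵛ (ℤ.- e3) (+ 0) e1 nz , trans (dot-vec₃ (ℤ.- e3) (+ 0) e1 e1 e2 e3 E) (e×ĵ·e≡0 e1 e2 e3) ,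
        trans (dot-vec₃ (ℤ.- e3) (+ 0) e1 f1 f2 f3 F) (trans (e×ĵ·f≡-w₂ e1 e3 f1 f2 f3) (cong ℤ.-_ w2))
...   | yes (_ , _ , e1≡0) with all-zero? (ℤ.- f3) (+ 0) f1
...     | no nz = vec₃ (ℤ.- f3) (+ 0) f1 , vec₃≢0ᵛ (ℤ.- f3) (+ 0) f1 nz , trans (dot-vec₃ (ℤ.- f3) (+ 0) f1 e1 e2 e3 E) (trans (f×ĵ·e≡w₂ e1 e2 e3 f1 f3) w2) ,
          trans (dot-vec₃ (ℤ.- f3) (+ 0) f1 f1 f2 f3 F) (e×ĵ·e≡0 f1 f2 f3)
...     | yes (_ , _ , f1≡0) = vec₃ (+ 1) (+ 0) (+ 0) , vec₃≢0ᵛ (+ 1) (+ 0) (+ 0) (λ { (() , _) }) ,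
          trans (dot-vec₃ (+ 1) (+ 0) (+ 0) e1 e2 e3 E) (trans (î·e≡e₁ e1 e2 e3) e1≡0) ,
          trans (dot-vec₃ (+ 1) (+ 0) (+ 0) f1 f2 f3 F) (trans (î·e≡e₁ f1 f2 f3) f1≡0)

-- Dimension and volume of two-segment sets

PreservesSumsTo : ∀ {d} (A : FinSet ℤ) → (Fin (size A) → Zd d) → Set
PreservesSumsTo A φ = ∀ i j l m → elt A i ℤ.+ elt A j ≡ elt A l ℤ.+ elt A m → φ i +ᵛ φ j ≡ φ l +ᵛ φ m

InRange? : ∀ s n m → Dec (InRange s n m)
InRange? s n m = (s ℕ.≤? m) ×-dec (m ℕ.<? s + n)

size≤vol : ∀ {d} (A : FinSet ℤ) (B : FinSet (Zd d)) n → FreimanIso A B → HullCount B n → size A ≤ n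
size≤vol A B n (φ , φinj , memB , _) (L , uL , memL , lenL) =
  ≤≡ (≡≤ (sym (trans (ListP.length-map φ (allFin (size A))) (ListP.length-tabulate id)))
     (unique-length-≤ (List.map φ (allFin (size A))) L (UniqP.map⁺ φinj (UniqP.allFin⁺ (size A))) sub)) lenL
  where
  sub : ∀ {x} → x ∈ List.map φ (allFin (size A)) → x ∈ L
  sub p with MemP.∈-map⁻ φ p
  ... | i , _ , refl with from (memB (φ i)) (i , refl)
  ...   | a , ea = from (memL (φ i)) (subst (InHull B) ea (elt∈hull B a))

module TwoSegIndex (k1 c k2 : ℕ) (A : FinSet ℤ) (memA : ∀ x → x ∈ₛ A ⇔ TwoSeg k1 c k2 x) where
  InTwoSeg? : ∀ m → Dec (InTwoSeg k1 c k2 m)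
  InTwoSeg? m = InRange? 0 k1 m ⊎-dec InRange? (k1 + c) k2 m

  idx : ∀ m → InTwoSeg k1 c k2 m → Fin (size A)
  idx m p = proj₁ (from (memA (+ m)) (m , refl , p))
  idx-elt : ∀ m p → elt A (idx m p) ≡ + m
  idx-elt m p = proj₂ (from (memA (+ m)) (m , refl , p))

  elt-in-TwoSeg : ∀ i → Σ ℕ λ m → elt A i ≡ + m × InTwoSeg k1 c k2 m
  elt-in-TwoSeg i = to (memA (elt A i)) (i , refl)

  idx-unique : ∀ i m p → elt A i ≡ + m → i ≡ idx m p
  idx-unique i m p e = inj A (trans e (sym (idx-elt m p)))

  idx-irrelevant : ∀ m p q → idx m p ≡ idx m q
  idx-irrelevant m p q = idx-unique (idx m p) m q (idx-elt m p)

  module Coordinates {d} (φ : Fin (size A) → Zd d) (rφ : PreservesSumsTo A φ) where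
    -- junk value 0 outside A
    coordinate : Fin d → ℕ → ℤ
    coordinate r m with InTwoSeg? m
    ... | yes p = lookup (φ (idx m p)) r
    ... | no _ = + 0

    coordinate-eq : ∀ r m p → coordinate r m ≡ lookup (φ (idx m p)) r
    coordinate-eq r m p with InTwoSeg? m
    ... | yes q = cong (λ i → lookup (φ i) r) (idx-irrelevant m q p)
    ... | no np = ⊥-elim (np p)

    coordinate-hom : ∀ r → PreservesSumsOn (InTwoSeg k1 c k2) (coordinate r)
    coordinate-hom r {a} {b} {c'} {d'} pa pb pc pd eq =
      trans (cong₂ ℤ._+_ (coordinate-eq r a pa) (coordinate-eq r b pb))
      (trans (sym (lookup-+ᵛ (φ (idx a pa)) (φ (idx b pb)) r))
      (trans (cong (λ v → lookup v r) (rφ _ _ _ _ (trans (cong₂ ℤ._+_ (idx-elt a pa) (idx-elt b pb))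
                 (trans (cong +_ eq) (sym (cong₂ ℤ._+_ (idx-elt c' pc) (idx-elt d' pd)))))))
      (trans (lookup-+ᵛ (φ (idx c' pc)) (φ (idx d' pd)) r)
             (sym (cong₂ ℤ._+_ (coordinate-eq r c' pc) (coordinate-eq r d' pd))))))

affine-unshift : ∀ x s b m d → x ℤ.+ s ℤ.* d ≡ b ℤ.+ m ℤ.* d → x ≡ b ℤ.+ (m ℤ.- s) ℤ.* d
affine-unshift x s b m d eq = trans (x+y≡z⇒x≡z-y x (s ℤ.* d) _ eq) (collect b m s d)
  where
  collect : ∀ b m s d → b ℤ.+ m ℤ.* d ℤ.- s ℤ.* d ≡ b ℤ.+ (m ℤ.- s) ℤ.* d
  collect = solveℤ

+-cancelˡ-≡ : ∀ a x y → a ℤ.+ x ≡ a ℤ.+ y → x ≡ y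
+-cancelˡ-≡ a x y eq = trans (rearrange a x) (trans (cong (ℤ._- a) (trans (ℤP.+-comm x a) (trans eq (ℤP.+-comm a y)))) (sym (rearrange a y)))
  where
  rearrange : ∀ a x → x ≡ x ℤ.+ a ℤ.- a
  rearrange = solveℤ

module OneDimensional (a1 c e : ℕ) (A : FinSet ℤ) (memA : ∀ x → x ∈ₛ A ⇔ TwoSeg (suc a1) c (suc (suc (c + e))) x) where
  k1 k2 a2 s2 N N' : ℕ
  k1 = suc a1
  a2 = suc (c + e)
  k2 = suc a2
  s2 = k1 + c
  N = s2 + a2
  N' = a1 + c + a2
  open TwoSegIndex k1 c k2 A memA

  p0 : InTwoSeg k1 c k2 0
  p0 = inj₁ (z≤n , s≤s z≤n)
  pN : InTwoSeg k1 c k2 N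
  pN = inj₂ (ℕP.m≤m+n s2 a2 , ℕP.+-monoʳ-< s2 (ℕP.n<1+n a2))
  i0 iN : Fin (size A)
  i0 = idx 0 p0
  iN = idx N pN

  i0≢iN : i0 ≢ iN
  i0≢iN eq with trans (sym (idx-elt 0 p0)) (trans (cong (elt A) eq) (idx-elt N pN))
  ... | ()

  elt≤N : ∀ i → Σ ℕ λ m → elt A i ≡ + m × m ≤ N
  elt≤N i with elt-in-TwoSeg i
  ... | m , eq , inj₁ (_ , lt) = m , eq , ℕP.≤-trans (ℕP.≤-pred lt) (ℕP.≤-trans (ℕP.m≤m+n a1 c) (ℕP.≤-trans (ℕP.n≤1+n _) (ℕP.m≤m+n s2 a2)))
  ... | m , eq , inj₂ (_ , lt) = m , eq , <+suc⇒≤ {s = s2} {a = a2} lt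

  -- Each coordinate of a Freiman image is affine in m, so the image lies on a line P + tE;
  -- a nonzero vector orthogonal to E then puts it in a hyperplane once d' ≥ 2.
  dim≤1 : ∀ d' (B : FinSet (Zd d')) → ¬ InHyperplane B → FreimanIso A B → d' ≤ 1
  dim≤1 zero B _ _ = z≤n
  dim≤1 (suc zero) B _ _ = s≤s z≤n
  dim≤1 (suc (suc d)) B nh (φ , φinj , memB , rel⇔) = ⊥-elim (nh hyp)
    where
    rφ : PreservesSumsTo A φ
    rφ i j l m eq = to (rel⇔ i j l m) eq
    open Coordinates φ rφ
    module R (r : Fin (suc (suc d))) = RigidityLongSecond a1 c e (coordinate r) (coordinate-hom r)
    Pv Ev : Zd (suc (suc d))
    Pv = Vec.tabulate (λ r → R.B r)
    Ev = Vec.tabulate (λ r → R.D r)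
    cv : Zd (suc (suc d))
    cv = proj₁ (orthogonal₁ Ev)
    lin : ∀ i r → lookup (φ i) r ≡ lookup Pv r ℤ.+ (+ proj₁ (elt-in-TwoSeg i) ℤ.- + s2) ℤ.* lookup Ev r
    lin i r with elt-in-TwoSeg i
    ... | m , e' , p = trans (cong (λ j → lookup (φ j) r) (idx-unique i m p e'))
        (trans (sym (coordinate-eq r m p))
          (trans (affine-unshift (coordinate r m) (+ s2) (R.B r) (+ m) (R.D r) (R.affine-shifted r m p))
            (sym (cong₂ (λ u v → u ℤ.+ (+ m ℤ.- + s2) ℤ.* v) (VecP.lookup∘tabulate (λ r → R.B r) r) (VecP.lookup∘tabulate (λ r → R.D r) r)))))
    dotφ : ∀ i → dot cv (φ i) ≡ dot cv Pv
    dotφ i = trans (dot-affine cv (φ i) Pv Ev (+ proj₁ (elt-in-TwoSeg i) ℤ.- + s2) (lin i))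
               (trans (cong (λ z → dot cv Pv ℤ.+ (+ proj₁ (elt-in-TwoSeg i) ℤ.- + s2) ℤ.* z) (proj₂ (proj₂ (orthogonal₁ Ev))))
                 (trans (cong (λ z → dot cv Pv ℤ.+ z) (ℤP.*-zeroʳ (+ proj₁ (elt-in-TwoSeg i) ℤ.- + s2))) (ℤP.+-identityʳ (dot cv Pv))))
    hyp : InHyperplane B
    hyp = cv , proj₁ (proj₂ (orthogonal₁ Ev)) , dot cv Pv ,
          λ i → let (j , ej) = to (memB (elt B i)) (i , refl) in trans (cong (dot cv) (sym ej)) (dotφ j)

  asℤ¹ : FinSet (Zd 1)
  asℤ¹ = record { size = size A ; elt = λ i → elt A i ∷ [] ; inj = λ eq → inj A (VecP.∷-injectiveˡ eq) }

  freiman-asℤ¹ : FreimanIso A asℤ¹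
  freiman-asℤ¹ = elt asℤ¹ , inj asℤ¹ , (λ y → mk⇔ id id) ,
         λ i j l m → mk⇔ (cong (λ z → z ∷ [])) VecP.∷-injectiveˡ

  ¬InHyperplane₁ : ¬ InHyperplane asℤ¹
  ¬InHyperplane₁ ((c0 ∷ []) , cnz , t , all) = cnz (cong (λ z → z ∷ []) c0≡0)
    where
    e0 : c0 ℤ.* + 0 ℤ.+ + 0 ≡ t
    e0 = subst (λ z → c0 ℤ.* z ℤ.+ + 0 ≡ t) (idx-elt 0 p0) (all i0)
    eN : c0 ℤ.* + N ℤ.+ + 0 ≡ t
    eN = subst (λ z → c0 ℤ.* z ℤ.+ + 0 ≡ t) (idx-elt N pN) (all iN)
    prod : c0 ℤ.* + N ≡ + 0
    prod = trans (sym (ℤP.+-identityʳ _)) (trans eN (trans (sym e0) (trans (ℤP.+-identityʳ _) (ℤP.*-zeroʳ c0))))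
    c0≡0 : c0 ≡ + 0
    c0≡0 with ℤP.i*j≡0⇒i≡0∨j≡0 c0 prod
    ... | inj₁ z = z
    ... | inj₂ ()

  open HullSegment N'

  hullPoints₁ : List (Zd 1)
  hullPoints₁ = List.map (λ z → z ∷ []) (range 0 (suc N))

  hullCount₁ : HullCount asℤ¹ (suc N)
  hullCount₁ = hullPoints₁ , UniqP.map⁺ VecP.∷-injectiveˡ (range-unique 0 (suc N)) , (λ x → mk⇔ (fw x) (bw x)) ,
          trans (ListP.length-map _ (range 0 (suc N))) (length-range 0 (suc N))
    where
    fw : ∀ x → x ∈ hullPoints₁ → InHull asℤ¹ x
    fw x p with MemP.∈-map⁻ (λ z → z ∷ []) p
    ... | y , q , refl with range⁻ q
    ...   | m , refl , (_ , lt) =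
      subst (InHull asℤ¹) (cong (λ z → z ∷ []) (trans (ℤP.+-identityˡ (+ m ℤ.* + 1)) (ℤP.*-identityʳ (+ m))))
        (between-in-hull asℤ¹ i0 iN i0≢iN (+ 0) (+ N) (+ 1) (cong (λ z → z ∷ []) (idx-elt 0 p0)) (cong (λ z → z ∷ []) (idx-elt N pN))
                (N ∸ m) m (ℕP.m∸n+n≡m (ℕP.≤-pred lt)) (unit-step (+ N)))
      where
      unit-step : ∀ n → n ≡ + 0 ℤ.+ n ℤ.* + 1
      unit-step = solveℤ
    bw : ∀ x → InHull asℤ¹ x → x ∈ hullPoints₁
    bw (x0 ∷ []) h = subst (λ z → (z ∷ []) ∈ hullPoints₁) (ℤP.0≤i⇒+∣i∣≡i lo)
                       (MemP.∈-map⁺ (λ z → z ∷ []) (range⁺ (z≤n , s≤s (ℤP.drop‿+≤+ (subst (ℤ._≤ + N) (sym (ℤP.0≤i⇒+∣i∣≡i lo)) hi)))))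
      where
      open HullBounds asℤ¹ (x0 ∷ []) h
      hi : x0 ℤ.≤ + N
      hi = hull-le Fin.zero (+ N) (λ i → inj₂ (let (m , eq , le) = elt≤N i in subst (ℤ._≤ + N) (sym eq) (ℤ.+≤+ le)))
      lo : + 0 ℤ.≤ x0
      lo = hull-ge Fin.zero (+ 0) (λ i → inj₂ (let (m , eq , le) = elt≤N i in subst (+ 0 ℤ.≤_) (sym eq) (ℤ.+≤+ z≤n)))

  -- A Freiman image contains P and P + N·D with D ≠ 0, hence the N + 1 hull points P + t·D.
  vol≥N+1 : ∀ (B : FinSet (Zd 1)) n → FreimanIso A B → HullCount B n → suc N ≤ n
  vol≥N+1 B n (φ , φinj , memB , rel⇔) (L , uL , memL , lenL) =
    ≤≡ (≡≤ (sym (trans (ListP.length-map pt (range 0 (suc N))) (length-range 0 (suc N))))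
           (unique-length-≤ (List.map pt (range 0 (suc N))) L (UniqP.map⁺ pt-inj (range-unique 0 (suc N))) sub)) lenL
    where
    rφ : PreservesSumsTo A φ
    rφ i j l m eq = to (rel⇔ i j l m) eq
    open Coordinates φ rφ
    module R = RigidityLongSecond a1 c e (coordinate Fin.zero) (coordinate-hom Fin.zero)
    G : ℕ → ℤ
    G = coordinate Fin.zero
    D : ℤ
    D = R.D
    linm : ∀ m (p : InTwoSeg k1 c k2 m) → G m ≡ R.B ℤ.+ (+ m ℤ.- + s2) ℤ.* D
    linm m p = affine-unshift (G m) (+ s2) R.B (+ m) D (R.affine-shifted m p)
    GN : G N ≡ G 0 ℤ.+ + N ℤ.* D
    GN = trans (linm N pN) (trans (rearrange R.B D (+ s2) (+ N)) (cong (λ z → z ℤ.+ + N ℤ.* D) (sym (linm 0 p0))))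
      where
      rearrange : ∀ B D S N → B ℤ.+ (N ℤ.- S) ℤ.* D ≡ (B ℤ.+ (+ 0 ℤ.- S) ℤ.* D) ℤ.+ N ℤ.* D
      rearrange = solveℤ
    vec1 : ∀ m (p : InTwoSeg k1 c k2 m) → φ (idx m p) ≡ G m ∷ []
    vec1 m p = vec-ext (φ (idx m p)) (G m ∷ []) (λ { Fin.zero → sym (coordinate-eq Fin.zero m p) })
    ps0 : InTwoSeg k1 c k2 (s2 + 0)
    ps0 = inj₂ (ℕP.m≤m+n s2 0 , ℕP.+-monoʳ-< s2 (s≤s z≤n))
    ps1 : InTwoSeg k1 c k2 (s2 + 1)
    ps1 = inj₂ (ℕP.m≤m+n s2 1 , ℕP.+-monoʳ-< s2 (s≤s (s≤s z≤n)))
    D≢0 : D ≢ + 0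
    D≢0 eq with trans (sym (idx-elt (s2 + 1) ps1)) (trans (cong (elt A) (φinj (trans (vec1 (s2 + 1) ps1)
                  (trans (cong (λ z → z ∷ []) (ℤP.i-j≡0⇒i≡j (G (s2 + 1)) (G (s2 + 0)) eq)) (sym (vec1 (s2 + 0) ps0)))))) (idx-elt (s2 + 0) ps0))
    ... | e1 = ℕP.<-irrefl (sym (ℤP.+-injective e1)) (ℕP.+-monoʳ-< s2 (s≤s z≤n))
    instance
      nzD : ℤ.NonZero D
      nzD = ℤ.≢-nonZero D≢0
    pt : ℤ → Zd 1
    pt x = (G 0 ℤ.+ x ℤ.* D) ∷ []
    pt-inj : ∀ {x y} → pt x ≡ pt y → x ≡ y
    pt-inj {x} {y} eq = ℤP.*-cancelʳ-≡ x y D (+-cancelˡ-≡ (G 0) (x ℤ.* D) (y ℤ.* D) (VecP.∷-injectiveˡ eq))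
    a b : Fin (size B)
    a = proj₁ (from (memB (φ i0)) (i0 , refl))
    b = proj₁ (from (memB (φ iN)) (iN , refl))
    ea : elt B a ≡ G 0 ∷ []
    ea = trans (proj₂ (from (memB (φ i0)) (i0 , refl))) (vec1 0 p0)
    eb : elt B b ≡ G N ∷ []
    eb = trans (proj₂ (from (memB (φ iN)) (iN , refl))) (vec1 N pN)
    a≢b : a ≢ b
    a≢b eq = i0≢iN (φinj (trans (sym (proj₂ (from (memB (φ i0)) (i0 , refl))))
                   (trans (cong (elt B) eq) (proj₂ (from (memB (φ iN)) (iN , refl))))))
    sub : ∀ {z} → z ∈ List.map pt (range 0 (suc N)) → z ∈ L
    sub p with MemP.∈-map⁻ pt {xs = range 0 (suc N)} p
    ... | y , y∈ , refl with range⁻ y∈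
    ...   | m , refl , (_ , m<) = from (memL (pt (+ m)))
            (between-in-hull B a b a≢b (G 0) (G N) D ea eb (N ∸ m) m (ℕP.m∸n+n≡m (ℕP.≤-pred m<)) GN)

  dim≡1 : Dim A 1
  dim≡1 = (asℤ¹ , ¬InHyperplane₁ , freiman-asℤ¹) , dim≤1

  vol≡N+1 : Vol A 1 (suc N)
  vol≡N+1 = (asℤ¹ , freiman-asℤ¹ , hullCount₁) , vol≥N+1

module BaseDigits (s2 : ℕ) where
  digits-unique : ∀ t δ t' δ' → δ ≤ 1 → δ' ≤ 1 → t < s2 → t' < s2 → t + δ * s2 ≡ t' + δ' * s2 → t ≡ t' × δ ≡ δ'
  digits-unique t 0 t' 0 _ _ _ _ eq = trans (sym (ℕP.+-identityʳ t)) (trans eq (ℕP.+-identityʳ t')) , refl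
  digits-unique t 1 t' 1 _ _ _ _ eq = ℕP.+-cancelʳ-≡ (s2 + 0) t t' eq , refl
  digits-unique t 0 t' 1 _ _ lt _ eq = ⊥-elim (ℕP.<-irrefl refl (ℕP.<-≤-trans lt le))
    where
    le : s2 ≤ t
    le = ≤≡ (≤≡ (ℕP.≤-trans (≡≤ (sym (ℕP.+-identityʳ s2)) ℕP.≤-refl) (ℕP.m≤n+m (s2 + 0) t')) (sym eq)) (ℕP.+-identityʳ t)
  digits-unique t 1 t' 0 _ _ _ lt eq = ⊥-elim (ℕP.<-irrefl refl (ℕP.<-≤-trans lt le))
    where
    le : s2 ≤ t'
    le = ≤≡ (≤≡ (ℕP.≤-trans (≡≤ (sym (ℕP.+-identityʳ s2)) ℕP.≤-refl) (ℕP.m≤n+m (s2 + 0) t)) eq) (ℕP.+-identityʳ t')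
  digits-unique t (suc (suc _)) t' _ (s≤s ()) _ _ _ _
  digits-unique t _ t' (suc (suc _)) _ (s≤s ()) _ _ _

  carry⇒≥base : ∀ T T' Δ k → T + Δ * s2 ≡ T' + (Δ + suc k) * s2 → s2 ≤ T
  carry⇒≥base T T' Δ k eq = ≤≡ (ℕP.≤-trans (ℕP.m≤n+m s2 T') (ℕP.m≤m+n (T' + s2) (k * s2)))
                           (sym (ℕP.+-cancelʳ-≡ (Δ * s2) T (T' + s2 + k * s2) (trans eq (rearrange T' Δ k s2))))
    where
    rearrange : ∀ T' Δ k s → T' + (Δ + suc k) * s ≡ (T' + s + k * s) + Δ * s
    rearrange = solveℕ

  digits-unique-upTo2 : ∀ T T' Δ Δ' → Δ ≤ 2 → Δ' ≤ 2 → (Δ ≤ 1 → T < s2) → (Δ' ≤ 1 → T' < s2) →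
         T + Δ * s2 ≡ T' + Δ' * s2 → T ≡ T' × Δ ≡ Δ'
  digits-unique-upTo2 T T' Δ Δ' h h' b b' eq with ℕP.<-cmp Δ Δ'
  ... | tri≈ _ refl _ = ℕP.+-cancelʳ-≡ (Δ * s2) T T' eq , refl
  ... | tri< lt _ _ with ℕP.m≤n⇒∃[o]m+o≡n lt
  ...   | k , refl = ⊥-elim (ℕP.<-irrefl refl (ℕP.<-≤-trans (b Δ≤1) (carry⇒≥base T T' Δ k (trans eq (cong (λ z → T' + z * s2) (sym (ℕP.+-suc Δ k)))))))
    where
    Δ≤1 : Δ ≤ 1
    Δ≤1 = ℕP.≤-pred (ℕP.≤-trans lt h')
  digits-unique-upTo2 T T' Δ Δ' h h' b b' eq | tri> _ _ gt with ℕP.m≤n⇒∃[o]m+o≡n gt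
  ...   | k , refl = ⊥-elim (ℕP.<-irrefl refl (ℕP.<-≤-trans (b' Δ≤1) (carry⇒≥base T' T Δ' k (trans (sym eq) (cong (λ z → T + z * s2) (sym (ℕP.+-suc Δ' k)))))))
    where
    Δ≤1 : Δ' ≤ 1
    Δ≤1 = ℕP.≤-pred (ℕP.≤-trans gt h)

module TwoDimensional (a1 c a2 : ℕ) (h1 : a1 ≤ c) (h2 : a2 ≤ c) (A : FinSet ℤ)
               (memA : ∀ x → x ∈ₛ A ⇔ TwoSeg (suc a1) c (suc a2) x) where
  k1 k2 s2 : ℕ
  k1 = suc a1
  k2 = suc a2
  s2 = k1 + c
  open TwoSegIndex k1 c k2 A memA
  open BaseDigits s2

  digits : ∀ m → InTwoSeg k1 c k2 m → ℕ × ℕ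
  digits m (inj₁ _) = m , 0
  digits m (inj₂ _) = m ∸ s2 , 1

  digits-value : ∀ m p → proj₁ (digits m p) + proj₂ (digits m p) * s2 ≡ m
  digits-value m (inj₁ _) = ℕP.+-identityʳ m
  digits-value m (inj₂ (lo , _)) = trans (cong (λ z → m ∸ s2 + z) (ℕP.+-identityʳ s2)) (ℕP.m∸n+n≡m lo)

  digits-bounds : ∀ m p → (proj₂ (digits m p) ≡ 0 × proj₁ (digits m p) ≤ a1) ⊎ (proj₂ (digits m p) ≡ 1 × proj₁ (digits m p) ≤ a2)
  digits-bounds m (inj₁ (_ , lt)) = inj₁ (refl , ℕP.≤-pred lt)
  digits-bounds m (inj₂ (lo , hi)) = inj₂ (refl , ≤≡ (ℕP.∸-monoˡ-≤ s2 (<+suc⇒≤ {s = s2} {a = a2} hi)) (ℕP.m+n∸m≡n s2 a2))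

  column row : Fin (size A) → ℕ
  column i = proj₁ (digits (proj₁ (elt-in-TwoSeg i)) (proj₂ (proj₂ (elt-in-TwoSeg i))))
  row i = proj₂ (digits (proj₁ (elt-in-TwoSeg i)) (proj₂ (proj₂ (elt-in-TwoSeg i))))

  value : ∀ i → elt A i ≡ + (column i + row i * s2)
  value i = trans (proj₁ (proj₂ (elt-in-TwoSeg i))) (cong +_ (sym (digits-value _ (proj₂ (proj₂ (elt-in-TwoSeg i))))))

  bounds : ∀ i → (row i ≡ 0 × column i ≤ a1) ⊎ (row i ≡ 1 × column i ≤ a2)
  bounds i = digits-bounds _ (proj₂ (proj₂ (elt-in-TwoSeg i)))

  a1<s2 : a1 < s2
  a1<s2 = s≤s (ℕP.m≤m+n a1 c)
  a2<s2 : a2 < s2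
  a2<s2 = s≤s (ℕP.≤-trans h2 (ℕP.m≤n+m c a1))

  row≤1 : ∀ i → row i ≤ 1
  row≤1 i with bounds i
  ... | inj₁ (e , _) = subst (_≤ 1) (sym e) z≤n
  ... | inj₂ (e , _) = subst (_≤ 1) (sym e) ℕP.≤-refl
  column<s₂ : ∀ i → column i < s2
  column<s₂ i with bounds i
  ... | inj₁ (_ , le) = ℕP.≤-<-trans le a1<s2
  ... | inj₂ (_ , le) = ℕP.≤-<-trans le a2<s2

  ρ : Fin (size A) → Zd 2
  ρ i = + column i ∷ + row i ∷ []

  ρ-of : ∀ i t δ → δ ≤ 1 → t < s2 → elt A i ≡ + (t + δ * s2) → ρ i ≡ + t ∷ + δ ∷ []
  ρ-of i t δ hδ ht e with digits-unique (column i) (row i) t δ (row≤1 i) hδ (column<s₂ i) ht (ℤP.+-injective (trans (sym (value i)) e))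
  ... | refl , refl = refl

  ρinj : Injective _≡_ _≡_ ρ
  ρinj {i} {j} eq = inj A (trans (value i) (trans (cong₂ (λ u v → + (u + v * s2)) (ℤP.+-injective (VecP.∷-injectiveˡ eq))
                      (ℤP.+-injective (VecP.∷-injectiveˡ (VecP.∷-injectiveʳ eq)))) (sym (value j))))

  -- Here k₁, k₂ ≤ c + 1 is used: adding two points of A never carries into the row digit.
  column-sum<s₂ : ∀ i j → row i + row j ≤ 1 → column i + column j < s2
  column-sum<s₂ i j le with bounds i | bounds j
  ... | inj₁ (_ , u) | inj₁ (_ , v) = s≤s (ℕP.+-mono-≤ u (ℕP.≤-trans v h1))
  ... | inj₁ (_ , u) | inj₂ (_ , v) = s≤s (ℕP.+-mono-≤ u (ℕP.≤-trans v h2))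
  ... | inj₂ (_ , u) | inj₁ (_ , v) = s≤s (≤≡ (ℕP.+-mono-≤ (ℕP.≤-trans u h2) v) (ℕP.+-comm c a1))
  ... | inj₂ (e1 , _) | inj₂ (e2 , _) = ⊥-elim (two≰one (subst (_≤ 1) (cong₂ _+_ e1 e2) le))
    where
    two≰one : ¬ (2 ≤ 1)
    two≰one (s≤s ())

  row-sum≤2 : ∀ i j → row i + row j ≤ 2
  row-sum≤2 i j = ℕP.+-mono-≤ (row≤1 i) (row≤1 j)

  rel⇔ : ∀ i j l m → (elt A i ℤ.+ elt A j ≡ elt A l ℤ.+ elt A m) ⇔ (ρ i +ᵛ ρ j ≡ ρ l +ᵛ ρ m)
  rel⇔ i j l m = mk⇔ fw bw
    where
    sumv : ∀ i j → elt A i ℤ.+ elt A j ≡ + ((column i + column j) + (row i + row j) * s2)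
    sumv i j = trans (cong₂ ℤ._+_ (value i) (value j)) (cong +_ (collect (column i) (row i) (column j) (row j) s2))
      where
      collect : ∀ a b c d s → (a + b * s) + (c + d * s) ≡ (a + c) + (b + d) * s
      collect = solveℕ
    fw : elt A i ℤ.+ elt A j ≡ elt A l ℤ.+ elt A m → ρ i +ᵛ ρ j ≡ ρ l +ᵛ ρ m
    fw eq with digits-unique-upTo2 (column i + column j) (column l + column m) (row i + row j) (row l + row m) (row-sum≤2 i j) (row-sum≤2 l m) (column-sum<s₂ i j) (column-sum<s₂ l m)
                 (ℤP.+-injective (trans (sym (sumv i j)) (trans eq (sumv l m))))
    ... | e1 , e2 = cong₂ (λ u v → + u ∷ + v ∷ []) e1 e2
    bw : ρ i +ᵛ ρ j ≡ ρ l +ᵛ ρ m → elt A i ℤ.+ elt A j ≡ elt A l ℤ.+ elt A m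
    bw eq = trans (sumv i j) (trans (cong₂ (λ u v → + (u + v * s2)) (ℤP.+-injective (VecP.∷-injectiveˡ eq))
                     (ℤP.+-injective (VecP.∷-injectiveˡ (VecP.∷-injectiveʳ eq)))) (sym (sumv l m)))

  img : ∀ y → TwoRows k1 k2 y ⇔ (∃ λ i → ρ i ≡ y)
  img y = mk⇔ (fw y) bw
    where
    fw : ∀ y → TwoRows k1 k2 y → ∃ λ i → ρ i ≡ y
    fw (+ t ∷ .(+ 0) ∷ []) (inj₁ (refl , _ , ℤ.+<+ lt)) =
      idx t (inj₁ (z≤n , lt)) , ρ-of _ t 0 z≤n (ℕP.<-≤-trans lt (ℕP.m≤m+n k1 c))
        (trans (idx-elt t _) (cong +_ (sym (ℕP.+-identityʳ t))))
    fw (+ t ∷ .(+ 1) ∷ []) (inj₂ (refl , _ , ℤ.+<+ lt)) =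
      idx (s2 + t) (inj₂ (ℕP.m≤m+n s2 t , ℕP.+-monoʳ-< s2 lt)) ,
      ρ-of _ t 1 ℕP.≤-refl (ℕP.<-≤-trans lt a2<s2)
        (trans (idx-elt (s2 + t) _) (cong +_ (trans (ℕP.+-comm s2 t) (cong (λ z → t + z) (sym (ℕP.+-identityʳ s2))))))
    fw (-[1+ n ] ∷ _ ∷ []) (inj₁ (_ , () , _))
    fw (-[1+ n ] ∷ _ ∷ []) (inj₂ (_ , () , _))
    bw : (∃ λ i → ρ i ≡ y) → TwoRows k1 k2 y
    bw (i , refl) with bounds i
    ... | inj₁ (e , le) = inj₁ (cong +_ e , ℤ.+≤+ z≤n , ℤ.+<+ (s≤s le))
    ... | inj₂ (e , le) = inj₂ (cong +_ e , ℤ.+≤+ z≤n , ℤ.+<+ (s≤s le))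

  asTwoRows : FinSet (Zd 2)
  asTwoRows = record { size = size A ; elt = ρ ; inj = ρinj }

  isoTwoRows : FreimanIsoTo ℤ._+_ _+ᵛ_ A (TwoRows k1 k2)
  isoTwoRows = ρ , ρinj , img , rel⇔

  freiman-asTwoRows : FreimanIso A asTwoRows
  freiman-asTwoRows = ρ , ρinj , (λ y → mk⇔ id id) , rel⇔

  ¬InHyperplane₂ : (1 ≤ a1 ⊎ 1 ≤ a2) → ¬ InHyperplane asTwoRows
  ¬InHyperplane₂ long ((c0 ∷ c1 ∷ []) , cnz , t , all) = cnz (cong₂ (λ u v → u ∷ v ∷ []) c0≡0 c1≡0)
    where
    p00 : InTwoSeg k1 c k2 0
    p00 = inj₁ (z≤n , s≤s z≤n)
    p01 : InTwoSeg k1 c k2 s2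
    p01 = inj₂ (ℕP.≤-refl , ℕP.m<m+n s2 (s≤s z≤n))
    ρ00 : ρ (idx 0 p00) ≡ + 0 ∷ + 0 ∷ []
    ρ00 = ρ-of _ 0 0 z≤n (s≤s z≤n) (idx-elt 0 p00)
    ρ01 : ρ (idx s2 p01) ≡ + 0 ∷ + 1 ∷ []
    ρ01 = ρ-of _ 0 1 ℕP.≤-refl (s≤s z≤n) (trans (idx-elt s2 p01) (cong +_ (sym (ℕP.+-identityʳ s2))))
    dotρ : ∀ i {x y} → ρ i ≡ x ∷ y ∷ [] → c0 ℤ.* x ℤ.+ (c1 ℤ.* y ℤ.+ + 0) ≡ t
    dotρ i eq = trans (cong (dot (c0 ∷ c1 ∷ [])) (sym eq)) (all i)
    c·00 : ∀ c0 c1 → c0 ℤ.* + 0 ℤ.+ (c1 ℤ.* + 0 ℤ.+ + 0) ≡ + 0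
    c·00 = solveℤ
    c·01 : ∀ c0 c1 → c0 ℤ.* + 0 ℤ.+ (c1 ℤ.* + 1 ℤ.+ + 0) ≡ c1
    c·01 = solveℤ
    c·10 : ∀ c0 c1 → c0 ℤ.* + 1 ℤ.+ (c1 ℤ.* + 0 ℤ.+ + 0) ≡ c0
    c·10 = solveℤ
    c·11 : ∀ c0 c1 → c0 ℤ.* + 1 ℤ.+ (c1 ℤ.* + 1 ℤ.+ + 0) ≡ c0 ℤ.+ c1
    c·11 = solveℤ
    t≡0 : t ≡ + 0
    t≡0 = trans (sym (dotρ _ ρ00)) (c·00 c0 c1)
    c1≡0 : c1 ≡ + 0
    c1≡0 = trans (sym (c·01 c0 c1)) (trans (dotρ _ ρ01) t≡0)
    c0≡0 : c0 ≡ + 0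
    c0≡0 = c0≡0' long
      where
      c0≡0' : (1 ≤ a1 ⊎ 1 ≤ a2) → c0 ≡ + 0
      c0≡0' (inj₁ le) = trans (sym (c·10 c0 c1)) (trans (dotρ _ (ρ-of (idx 1 p10) 1 0 z≤n (ℕP.≤-<-trans le a1<s2) (idx-elt 1 p10))) t≡0)
        where
        p10 : InTwoSeg k1 c k2 1
        p10 = inj₁ (z≤n , s≤s le)
      c0≡0' (inj₂ le) = trans (trans (sym (ℤP.+-identityʳ c0)) (trans (cong (λ z → c0 ℤ.+ z) (sym c1≡0)) (sym (c·11 c0 c1))))
                      (trans (dotρ _ (ρ-of (idx (s2 + 1) p11) 1 1 ℕP.≤-refl (ℕP.≤-<-trans le a2<s2)
                         (trans (idx-elt (s2 + 1) p11) (cong +_ (trans (ℕP.+-comm s2 1) (cong suc (sym (ℕP.+-identityʳ s2)))))))) t≡0)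
        where
        p11 : InTwoSeg k1 c k2 (s2 + 1)
        p11 = inj₂ (ℕP.m≤m+n s2 1 , ℕP.+-monoʳ-< s2 (s≤s le))

  -- A Freiman image lies on the two parallel lines P₀ + tE and P₁ + tE, hence in a hyperplane
  -- orthogonal to E and P₁ − P₀ once d' ≥ 3.
  dim≤2 : ∀ d' (B : FinSet (Zd d')) → ¬ InHyperplane B → FreimanIso A B → d' ≤ 2
  dim≤2 zero B _ _ = z≤n
  dim≤2 (suc zero) B _ _ = s≤s z≤n
  dim≤2 (suc (suc zero)) B _ _ = s≤s (s≤s z≤n)
  dim≤2 (suc (suc (suc d))) B nh (φ , φinj , memB , rel⇔') = ⊥-elim (nh hyp)
    where
    rφ : PreservesSumsTo A φ
    rφ i j l m eq = to (rel⇔' i j l m) eq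
    open Coordinates φ rφ
    module R (r : Fin (suc (suc (suc d)))) = RigidityShort k1 c k2 (coordinate r) (coordinate-hom r)
    Dr : Fin (suc (suc (suc d))) → ℤ
    Dr r = proj₁ (R.affine r)
    P0 P1 Ev Fv : Zd (suc (suc (suc d)))
    P0 = Vec.tabulate (λ r → coordinate r 0)
    P1 = Vec.tabulate (λ r → coordinate r (s2 + 0))
    Ev = Vec.tabulate Dr
    Fv = Vec.tabulate (λ r → coordinate r (s2 + 0) ℤ.- coordinate r 0)
    cv : Zd (suc (suc (suc d)))
    cv = proj₁ (orthogonal₂ Ev Fv)
    cv≢0 : cv ≢ 0ᵛ
    cv≢0 = proj₁ (proj₂ (orthogonal₂ Ev Fv))
    cE : dot cv Ev ≡ + 0
    cE = proj₁ (proj₂ (proj₂ (orthogonal₂ Ev Fv)))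
    cF : dot cv Fv ≡ + 0
    cF = proj₂ (proj₂ (proj₂ (orthogonal₂ Ev Fv)))
    lt : ∀ {f : Fin (suc (suc (suc d))) → ℤ} r → lookup (Vec.tabulate f) r ≡ f r
    lt {f} r = VecP.lookup∘tabulate f r
    kill : ∀ (X : ℤ) a → X ℤ.+ a ℤ.* + 0 ≡ X
    kill X a = trans (cong (λ z → X ℤ.+ z) (ℤP.*-zeroʳ a)) (ℤP.+-identityʳ X)
    i≡j+1*[i-j] : ∀ i j → i ≡ j ℤ.+ + 1 ℤ.* (i ℤ.- j)
    i≡j+1*[i-j] = solveℤ
    dP1 : dot cv P1 ≡ dot cv P0
    dP1 = trans (dot-affine cv P1 P0 Fv (+ 1) (λ r → trans (lt {λ r → coordinate r (s2 + 0)} r) (trans (i≡j+1*[i-j] (coordinate r (s2 + 0)) (coordinate r 0))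
                  (sym (cong₂ (λ u v → u ℤ.+ + 1 ℤ.* v) (lt {λ r → coordinate r 0} r) (lt {λ r → coordinate r (s2 + 0) ℤ.- coordinate r 0} r))))))
                (trans (cong (λ z → dot cv P0 ℤ.+ + 1 ℤ.* z) cF) (kill (dot cv P0) (+ 1)))
    coord1 : ∀ i m (mlt : m < k1) → elt A i ≡ + m → ∀ r → lookup (φ i) r ≡ lookup P0 r ℤ.+ + m ℤ.* lookup Ev r
    coord1 i m mlt e r = trans (cong (λ j → lookup (φ j) r) (idx-unique i m (inj₁ (z≤n , mlt)) e))
                (trans (sym (coordinate-eq r m (inj₁ (z≤n , mlt)))) (trans (proj₁ (proj₂ (R.affine r)) m mlt)
                   (sym (cong₂ (λ u v → u ℤ.+ + m ℤ.* v) (lt {λ r → coordinate r 0} r) (lt {Dr} r)))))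
    coord2 : ∀ i j (lo : s2 ≤ s2 + j) (hi : s2 + j < s2 + k2) → elt A i ≡ + (s2 + j) → ∀ r → lookup (φ i) r ≡ lookup P1 r ℤ.+ + j ℤ.* lookup Ev r
    coord2 i j lo hi e r = trans (cong (λ j' → lookup (φ j') r) (idx-unique i (s2 + j) (inj₂ (lo , hi)) e))
                (trans (sym (coordinate-eq r (s2 + j) (inj₂ (lo , hi)))) (trans (proj₂ (proj₂ (R.affine r)) j (ℕP.+-cancelˡ-< s2 j k2 hi))
                   (sym (cong₂ (λ u v → u ℤ.+ + j ℤ.* v) (lt {λ r → coordinate r (s2 + 0)} r) (lt {Dr} r)))))
    dot1 : ∀ i m (mlt : m < k1) → elt A i ≡ + m → dot cv (φ i) ≡ dot cv P0
    dot1 i m mlt e = trans (dot-affine cv (φ i) P0 Ev (+ m) (coord1 i m mlt e))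
            (trans (cong (λ z → dot cv P0 ℤ.+ + m ℤ.* z) cE) (kill (dot cv P0) (+ m)))
    dot2 : ∀ i j (lo : s2 ≤ s2 + j) (hi : s2 + j < s2 + k2) → elt A i ≡ + (s2 + j) → dot cv (φ i) ≡ dot cv P0
    dot2 i j lo hi e = trans (dot-affine cv (φ i) P1 Ev (+ j) (coord2 i j lo hi e))
            (trans (cong (λ z → dot cv P1 ℤ.+ + j ℤ.* z) cE) (trans (kill (dot cv P1) (+ j)) dP1))
    disp2 : ∀ i m (lo : s2 ≤ m) (hi : m < s2 + k2) → elt A i ≡ + m → (Σ ℕ λ j → s2 + j ≡ m) → dot cv (φ i) ≡ dot cv P0
    disp2 i .(s2 + j) lo hi e (j , refl) = dot2 i j lo hi e
    disp : ∀ i → (Σ ℕ λ m → elt A i ≡ + m × InTwoSeg k1 c k2 m) → dot cv (φ i) ≡ dot cv P0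
    disp i (m , e , inj₁ (_ , mlt)) = dot1 i m mlt e
    disp i (m , e , inj₂ (lo , hi)) = disp2 i m lo hi e (ℕP.m≤n⇒∃[o]m+o≡n lo)
    dotφ : ∀ i → dot cv (φ i) ≡ dot cv P0
    dotφ i = disp i (elt-in-TwoSeg i)
    hyp : InHyperplane B
    hyp = cv , cv≢0 , dot cv P0 ,
          λ i → let (j , ej) = to (memB (elt B i)) (i , refl) in trans (cong (dot cv) (sym ej)) (dotφ j)

  0≢1 : 0 ≢ 1
  0≢1 ()

  atRow₀ atRow₁ : ℤ → Zd 2
  atRow₀ x = x ∷ + 0 ∷ []
  atRow₁ x = x ∷ + 1 ∷ []

  hullPoints₂ : List (Zd 2)
  hullPoints₂ = List.map atRow₀ (range 0 k1) ++ List.map atRow₁ (range 0 k2)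

  hullPoints₂-unique : Unique hullPoints₂
  hullPoints₂-unique = UniqP.++⁺ (UniqP.map⁺ VecP.∷-injectiveˡ (range-unique 0 k1)) (UniqP.map⁺ VecP.∷-injectiveˡ (range-unique 0 k2)) dis
    where
    dis : Disjoint (List.map atRow₀ (range 0 k1)) (List.map atRow₁ (range 0 k2))
    dis (p , q) with MemP.∈-map⁻ atRow₀ p | MemP.∈-map⁻ atRow₁ q
    ... | _ , _ , e1 | _ , _ , e2 with VecP.∷-injectiveˡ (VecP.∷-injectiveʳ (trans (sym e1) e2))
    ... | ()

  twoRows⊆hull : ∀ x → TwoRows k1 k2 x → InHull asTwoRows x
  twoRows⊆hull x tr = let (i , e) = to (img x) tr in subst (InHull asTwoRows) e (elt∈hull asTwoRows i)

  hullPoints₂⊆hull : ∀ x → x ∈ hullPoints₂ → InHull asTwoRows x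
  hullPoints₂⊆hull x p with MemP.∈-++⁻ (List.map atRow₀ (range 0 k1)) p
  ... | inj₁ q = onRow₀ (MemP.∈-map⁻ atRow₀ q)
    where
    onRow₀ : (Σ ℤ λ y → y ∈ range 0 k1 × x ≡ atRow₀ y) → InHull asTwoRows x
    onRow₀ (y , y∈ , refl) with range⁻ y∈
    ... | m , refl , (_ , m<) = twoRows⊆hull _ (inj₁ (refl , ℤ.+≤+ z≤n , ℤ.+<+ m<))
  ... | inj₂ q = onRow₁ (MemP.∈-map⁻ atRow₁ q)
    where
    onRow₁ : (Σ ℤ λ y → y ∈ range 0 k2 × x ≡ atRow₁ y) → InHull asTwoRows x
    onRow₁ (y , y∈ , refl) with range⁻ y∈
    ... | m , refl , (_ , m<) = twoRows⊆hull _ (inj₂ (refl , ℤ.+≤+ z≤n , ℤ.+<+ m<))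

  column≤a₁ : ∀ i → + row i ≡ + 0 → + column i ℤ.≤ + a1
  column≤a₁ i e with bounds i
  ... | inj₁ (_ , le) = ℤ.+≤+ le
  ... | inj₂ (e₁ , _) = ⊥-elim (0≢1 (trans (sym (ℤP.+-injective e)) e₁))

  column≤a₂ : ∀ i → + row i ≡ + 1 → + column i ℤ.≤ + a2
  column≤a₂ i e with bounds i
  ... | inj₂ (_ , le) = ℤ.+≤+ le
  ... | inj₁ (e₀ , _) = ⊥-elim (0≢1 (trans (sym e₀) (ℤP.+-injective e)))

  -- A hull point has 0 ≤ y ≤ 1; when y is extreme only points of that row carry weight,
  -- which bounds x by the length of the row.
  hull⊆hullPoints₂ : ∀ x → InHull asTwoRows x → x ∈ hullPoints₂
  hull⊆hullPoints₂ (x0 ∷ y0 ∷ []) h = onRow ℤ.∣ y0 ∣ ∣y∣≡y (ℤP.drop‿+≤+ (subst (ℤ._≤ + 1) (sym ∣y∣≡y) y≤1))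
    where
    open HullBounds asTwoRows (x0 ∷ y0 ∷ []) h
    ĵ : Fin 2
    ĵ = Fin.suc Fin.zero
    ∣x∣≡x : + ℤ.∣ x0 ∣ ≡ x0
    ∣x∣≡x = ℤP.0≤i⇒+∣i∣≡i (hull-ge Fin.zero (+ 0) (λ i → inj₂ (ℤ.+≤+ z≤n)))
    ∣y∣≡y : + ℤ.∣ y0 ∣ ≡ y0
    ∣y∣≡y = ℤP.0≤i⇒+∣i∣≡i (hull-ge ĵ (+ 0) (λ i → inj₂ (ℤ.+≤+ z≤n)))
    y≤1 : y0 ℤ.≤ + 1
    y≤1 = hull-le ĵ (+ 1) (λ i → inj₂ (ℤ.+≤+ (row≤1 i)))
    ∣x∣<1+ : ∀ {n} → x0 ℤ.≤ + n → ℤ.∣ x0 ∣ < suc n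
    ∣x∣<1+ le = s≤s (ℤP.drop‿+≤+ (subst (ℤ._≤ + _) (sym ∣x∣≡x) le))
    onRow : ∀ n → + n ≡ y0 → n ≤ 1 → (x0 ∷ y0 ∷ []) ∈ hullPoints₂
    onRow 0 e _ = subst (_∈ hullPoints₂) (cong₂ (λ u w → u ∷ w ∷ []) ∣x∣≡x e)
      (MemP.∈-++⁺ˡ (MemP.∈-map⁺ atRow₀ (range⁺ (z≤n , ∣x∣<1+ (hull-le Fin.zero (+ a1)
        (λ i → map₂ (column≤a₁ i) (tight-low ĵ (+ 0) (λ _ → ℤ.+≤+ z≤n) (sym e) i)))))))
    onRow 1 e _ = subst (_∈ hullPoints₂) (cong₂ (λ u w → u ∷ w ∷ []) ∣x∣≡x e)
      (MemP.∈-++⁺ʳ (List.map atRow₀ (range 0 k1)) (MemP.∈-map⁺ atRow₁ (range⁺ (z≤n , ∣x∣<1+ (hull-le Fin.zero (+ a2)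
        (λ i → map₂ (column≤a₂ i) (tight-up ĵ (+ 1) (λ i → ℤ.+≤+ (row≤1 i)) (sym e) i)))))))
    onRow (suc (suc _)) _ (s≤s ())

  hullCount₂ : HullCount asTwoRows (k1 + k2)
  hullCount₂ = hullPoints₂ , hullPoints₂-unique , (λ x → mk⇔ (hullPoints₂⊆hull x) (hull⊆hullPoints₂ x)) ,
          trans (ListP.length-++ (List.map atRow₀ (range 0 k1)) {List.map atRow₁ (range 0 k2)})
                (cong₂ _+_ (trans (ListP.length-map atRow₀ (range 0 k1)) (length-range 0 k1))
                           (trans (ListP.length-map atRow₁ (range 0 k2)) (length-range 0 k2)))

  dim≡2 : (1 ≤ a1 ⊎ 1 ≤ a2) → Dim A 2
  dim≡2 long = (asTwoRows , ¬InHyperplane₂ long , freiman-asTwoRows) , dim≤2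

  vol≡k : Vol A 2 (k1 + k2)
  vol≡k = (asTwoRows , freiman-asTwoRows , hullCount₂) , λ B n iso hc → ≡≤ (sym (TwoSegSet.size≡k₁+k₂ k1 c k2 A memA)) (size≤vol A B n iso hc)

-- Affine changes of coordinates

mapFS : (f : ℤ → ℤ) → (∀ {x y} → f x ≡ f y → x ≡ y) → FinSet ℤ → FinSet ℤ
mapFS f fi A = record { size = size A ; elt = λ i → f (elt A i) ; inj = λ eq → inj A (fi eq) }

-- Translations and reflections: since h (x + y) = f x + f y with f and h injective, A and its
-- image under f have the same additive quadruples and the same |2A|.
record Affine : Set where
  field
    f h : ℤ → ℤ
    fh : ∀ x y → f x ℤ.+ f y ≡ h (x ℤ.+ y)
    fi : ∀ {x y} → f x ≡ f y → x ≡ y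
    hi : ∀ {x y} → h x ≡ h y → x ≡ y

∘-affine : Affine → Affine → Affine
∘-affine F G = record
  { f = λ x → F.f (G.f x) ; h = λ z → F.h (G.h z)
  ; fh = λ x y → trans (F.fh (G.f x) (G.f y)) (cong F.h (G.fh x y))
  ; fi = λ eq → G.fi (F.fi eq) ; hi = λ eq → G.hi (F.hi eq) }
  where
  module F = Affine F
  module G = Affine G

module AffineTransfer (F : Affine) (A : FinSet ℤ) where
  open Affine F
  A' : FinSet ℤ
  A' = mapFS f fi A

  rel⇔ : ∀ i j l m → (elt A i ℤ.+ elt A j ≡ elt A l ℤ.+ elt A m) ⇔ (elt A' i ℤ.+ elt A' j ≡ elt A' l ℤ.+ elt A' m)
  rel⇔ i j l m = mk⇔ (λ eq → trans (fh _ _) (trans (cong h eq) (sym (fh _ _))))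
                     (λ eq → hi (trans (sym (fh _ _)) (trans eq (fh _ _))))

  isoTo-back : ∀ {G' : Set} {_⊕_ : G' → G' → G'} {S : G' → Set} →
               FreimanIsoTo ℤ._+_ _⊕_ A' S → FreimanIsoTo ℤ._+_ _⊕_ A S
  isoTo-back (φ , φi , img , rel) = φ , φi , img , λ i j l m → mk⇔ (λ e → to (rel i j l m) (to (rel⇔ i j l m) e))
                                                                  (λ e → from (rel⇔ i j l m) (from (rel i j l m) e))
  isoTo-fwd : ∀ {G' : Set} {_⊕_ : G' → G' → G'} {S : G' → Set} →
               FreimanIsoTo ℤ._+_ _⊕_ A S → FreimanIsoTo ℤ._+_ _⊕_ A' S
  isoTo-fwd (φ , φi , img , rel) = φ , φi , img , λ i j l m → mk⇔ (λ e → to (rel i j l m) (from (rel⇔ i j l m) e))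
                                                                  (λ e → to (rel⇔ i j l m) (from (rel i j l m) e))

  dim-back : ∀ {d} → Dim A' d → Dim A d
  dim-back ((B , nh , iso) , up) = (B , nh , isoTo-back {_⊕_ = _+ᵛ_} {S = λ y → y ∈ₛ B} iso) ,
                                   λ d' B' nh' iso' → up d' B' nh' (isoTo-fwd {_⊕_ = _+ᵛ_} {S = λ y → y ∈ₛ B'} iso')

  vol-back : ∀ {d v} → Vol A' d v → Vol A d v
  vol-back ((B , iso , hc) , low) = (B , isoTo-back {_⊕_ = _+ᵛ_} {S = λ y → y ∈ₛ B} iso , hc) ,
                                    λ B' n iso' hc' → low B' n (isoTo-fwd {_⊕_ = _+ᵛ_} {S = λ y → y ∈ₛ B'} iso') hc'

  sumset-eq : sumsetSizeℤ A' ≡ sumsetSizeℤ A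
  sumset-eq = trans (sumsetSize≡length A' (List.map h (sumsetList A)) (UniqP.map⁺ hi (sumsetList-unique A)) (λ x → mk⇔ fw bw))
                    (ListP.length-map h (sumsetList A))
    where
    fw : ∀ {x} → x ∈ List.map h (sumsetList A) → IsSum A' x
    fw p with MemP.∈-map⁻ h p
    ... | y , q , refl with sumsetList⁻ A q
    ...   | i , j , refl = i , j , fh (elt A i) (elt A j)
    bw : ∀ {x} → IsSum A' x → x ∈ List.map h (sumsetList A)
    bw (i , j , refl) = subst (_∈ List.map h (sumsetList A)) (sym (fh (elt A i) (elt A j))) (MemP.∈-map⁺ h (sumsetList⁺ A (i , j , refl)))

dim-uniq : ∀ {A : FinSet ℤ} {d d'} → Dim A d → Dim A d' → d ≡ d'
dim-uniq ((B , nh , iso) , up) ((B' , nh' , iso') , up') = ℕP.≤-antisym (up' _ B nh iso) (up _ B' nh' iso')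

vol-uniq : ∀ {A : FinSet ℤ} {d v v'} → Vol A d v → Vol A d v' → v ≡ v'
vol-uniq ((B , iso , hc) , low) ((B' , iso' , hc') , low') = ℕP.≤-antisym (low B' _ iso' hc') (low' B _ iso hc)

i≡[i-j]+j : ∀ i j → i ≡ (i ℤ.- j) ℤ.+ j
i≡[i-j]+j = solveℤ

translation : ℤ → Affine
translation L = record
  { f = λ x → x ℤ.- L ; h = λ z → z ℤ.- (L ℤ.+ L) ; fh = λ x y → distrib x y L
  ; fi = λ {x} {y} eq → trans (i≡[i-j]+j x L) (trans (cong (ℤ._+ L) eq) (sym (i≡[i-j]+j y L)))
  ; hi = λ {x} {y} eq → trans (i≡[i-j]+j x (L ℤ.+ L)) (trans (cong (ℤ._+ (L ℤ.+ L)) eq) (sym (i≡[i-j]+j y (L ℤ.+ L)))) }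
  where
  distrib : ∀ x y L → (x ℤ.- L) ℤ.+ (y ℤ.- L) ≡ (x ℤ.+ y) ℤ.- (L ℤ.+ L)
  distrib = solveℤ

reflection : ℤ → Affine
reflection M = record
  { f = λ x → M ℤ.- x ; h = λ z → (M ℤ.+ M) ℤ.- z ; fh = λ x y → distrib x y M
  ; fi = λ {x} {y} eq → trans (involutive x M) (trans (cong (λ w → M ℤ.- w) eq) (sym (involutive y M)))
  ; hi = λ {x} {y} eq → trans (involutive x (M ℤ.+ M)) (trans (cong (λ w → (M ℤ.+ M) ℤ.- w) eq) (sym (involutive y (M ℤ.+ M)))) }
  where
  distrib : ∀ x y M → (M ℤ.- x) ℤ.+ (M ℤ.- y) ≡ (M ℤ.+ M) ℤ.- (x ℤ.+ y)
  distrib = solveℤ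
  involutive : ∀ x M → x ≡ M ℤ.- (M ℤ.- x)
  involutive = solveℤ

+-cancelʳ-≤ : ∀ {x y} z → x ℤ.+ z ℤ.≤ y ℤ.+ z → x ℤ.≤ y
+-cancelʳ-≤ {x} {y} z le = subst₂ ℤ._≤_ (cancel x z) (cancel y z) (ℤP.+-monoˡ-≤ (ℤ.- z) le)
  where
  cancel : ∀ x z → (x ℤ.+ z) ℤ.+ ℤ.- z ≡ x
  cancel = solveℤ

0≤i≤+n⇒i≡+m : ∀ {i : ℤ} {n : ℕ} → + 0 ℤ.≤ i → i ℤ.≤ + n → Σ ℕ λ m → i ≡ + m × m ≤ n
0≤i≤+n⇒i≡+m {+ m} _ (ℤ.+≤+ le) = m , refl , le

i≤j⇒j-i≡+n : ∀ (i j : ℤ) → i ℤ.≤ j → Σ ℕ λ n → + n ≡ j ℤ.- i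
i≤j⇒j-i≡+n i j le = ℤ.∣ j ℤ.- i ∣ , ℤP.0≤i⇒+∣i∣≡i (ℤP.i≤j⇒0≤j-i le)

module Normalise (A : FinSet ℤ) (m1 n1 m2 n2 : ℤ) (le1 : m1 ℤ.≤ n1) (lt : n1 ℤ.+ + 1 ℤ.< m2) (le2 : m2 ℤ.≤ n2)
                 (memA : ∀ x → x ∈ₛ A ⇔ ((m1 ℤ.≤ x × x ℤ.≤ n1) ⊎ (m2 ℤ.≤ x × x ℤ.≤ n2))) where
  open AffineTransfer (translation m1) A public

  [i+j]-j≡i : ∀ i j → (i ℤ.+ j) ℤ.- j ≡ i
  [i+j]-j≡i = solveℤ

  mem-tr : ∀ z → z ∈ₛ A' ⇔ (z ℤ.+ m1) ∈ₛ A
  mem-tr z = mk⇔ (λ { (i , e) → i , trans (i≡[i-j]+j (elt A i) m1) (cong (ℤ._+ m1) e) })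
                 (λ { (i , e) → i , trans (cong (ℤ._- m1) e) ([i+j]-j≡i z m1) })

  -j+i≡i-j : ∀ i j → ℤ.- j ℤ.+ i ≡ i ℤ.- j
  -j+i≡i-j = solveℤ
  -j+[i+1]≡[i-j]+1 : ∀ i j → ℤ.- j ℤ.+ (i ℤ.+ + 1) ≡ (i ℤ.- j) ℤ.+ + 1
  -j+[i+1]≡[i-j]+1 = solveℤ

  m1≤m2 : m1 ℤ.≤ m2
  m1≤m2 = ℤP.≤-trans le1 (ℤP.≤-trans (ℤP.i≤i+j n1 (+ 1)) (ℤP.<⇒≤ lt))

  a s e2 : ℕ
  a = proj₁ (i≤j⇒j-i≡+n m1 n1 le1)
  s = proj₁ (i≤j⇒j-i≡+n m1 m2 m1≤m2)
  e2 = proj₁ (i≤j⇒j-i≡+n m1 n2 (ℤP.≤-trans m1≤m2 le2))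
  ea : + a ≡ n1 ℤ.- m1
  ea = proj₂ (i≤j⇒j-i≡+n m1 n1 le1)
  es : + s ≡ m2 ℤ.- m1
  es = proj₂ (i≤j⇒j-i≡+n m1 m2 m1≤m2)
  ee : + e2 ≡ n2 ℤ.- m1
  ee = proj₂ (i≤j⇒j-i≡+n m1 n2 (ℤP.≤-trans m1≤m2 le2))

  a2≤s : suc (suc a) ≤ s
  a2≤s = ≡≤ (cong suc (sym (ℕP.+-comm a 1))) (ℤP.drop‿+<+ (subst₂ ℤ._<_ (trans (-j+[i+1]≡[i-j]+1 n1 m1) (cong (ℤ._+ + 1) (sym ea))) (trans (-j+i≡i-j m2 m1) (sym es))
                        (ℤP.+-monoʳ-< (ℤ.- m1) lt)))

  s≤e2 : s ≤ e2
  s≤e2 = ℤP.drop‿+≤+ (subst₂ ℤ._≤_ (trans (-j+i≡i-j m2 m1) (sym es)) (trans (-j+i≡i-j n2 m1) (sym ee))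
                        (ℤP.+-monoʳ-≤ (ℤ.- m1) le2))

  c b : ℕ
  c = s ∸ suc a
  b = e2 ∸ s
  sc : suc a + c ≡ s
  sc = ℕP.m+[n∸m]≡n (ℕP.<⇒≤ a2≤s)
  sb : s + b ≡ e2
  sb = ℕP.m+[n∸m]≡n s≤e2
  1≤c : 1 ≤ c
  1≤c = ℕP.+-cancelˡ-≤ (suc a) 1 c (≤≡ (≡≤ (ℕP.+-comm (suc a) 1) a2≤s) (sym sc))

  n1≡ : n1 ≡ + a ℤ.+ m1
  n1≡ = trans (i≡[i-j]+j n1 m1) (cong (ℤ._+ m1) (sym ea))
  m2≡ : m2 ≡ + s ℤ.+ m1
  m2≡ = trans (i≡[i-j]+j m2 m1) (cong (ℤ._+ m1) (sym es))
  n2≡ : n2 ≡ + e2 ℤ.+ m1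
  n2≡ = trans (i≡[i-j]+j n2 m1) (cong (ℤ._+ m1) (sym ee))
  m1≡ : m1 ≡ + 0 ℤ.+ m1
  m1≡ = sym (ℤP.+-identityˡ m1)

  members : ∀ z → z ∈ₛ A' ⇔ TwoSeg (suc a) c (suc b) z
  members z = mk⇔ fw bw
    where
    fw : z ∈ₛ A' → TwoSeg (suc a) c (suc b) z
    fw p with to (memA (z ℤ.+ m1)) (to (mem-tr z) p)
    ... | inj₁ (lo , hi) with 0≤i≤+n⇒i≡+m (+-cancelʳ-≤ m1 (subst (ℤ._≤ z ℤ.+ m1) m1≡ lo)) (+-cancelʳ-≤ m1 (subst (z ℤ.+ m1 ℤ.≤_) n1≡ hi))
    ...   | m , e , le = m , e , inj₁ (z≤n , s≤s le)
    fw p | inj₂ (lo , hi) with 0≤i≤+n⇒i≡+m (ℤP.≤-trans (ℤ.+≤+ z≤n) lo') (+-cancelʳ-≤ m1 (subst (z ℤ.+ m1 ℤ.≤_) n2≡ hi))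
      where
      lo' : + s ℤ.≤ z
      lo' = +-cancelʳ-≤ m1 (subst (ℤ._≤ z ℤ.+ m1) m2≡ lo)
    ...   | m , refl , le = m , refl , inj₂ (≡≤ sc (ℤP.drop‿+≤+ (+-cancelʳ-≤ m1 (subst (ℤ._≤ + m ℤ.+ m1) m2≡ lo))) ,
                                          ≤⇒<+suc {s = suc a + c} {a = b} (≤≡ le (sym (trans (cong (λ q → q + b) sc) sb))))
    bw : TwoSeg (suc a) c (suc b) z → z ∈ₛ A'
    bw (m , refl , inj₁ (_ , s≤s le)) = from (mem-tr (+ m)) (from (memA (+ m ℤ.+ m1))
      (inj₁ (subst (ℤ._≤ + m ℤ.+ m1) (sym m1≡) (ℤP.+-monoˡ-≤ m1 (ℤ.+≤+ z≤n)) ,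
             subst (+ m ℤ.+ m1 ℤ.≤_) (sym n1≡) (ℤP.+-monoˡ-≤ m1 (ℤ.+≤+ le)))))
    bw (m , refl , inj₂ (lo , hi)) = from (mem-tr (+ m)) (from (memA (+ m ℤ.+ m1))
      (inj₂ (subst (ℤ._≤ + m ℤ.+ m1) (sym m2≡) (ℤP.+-monoˡ-≤ m1 (ℤ.+≤+ (≡≤ (sym sc) lo))) ,
             subst (+ m ℤ.+ m1 ℤ.≤_) (sym n2≡) (ℤP.+-monoˡ-≤ m1 (ℤ.+≤+ (≤≡ (<+suc⇒≤ {s = suc a + c} {a = b} hi) (trans (cong (λ q → q + b) sc) sb)))))))

  long-segment : (m1 ℤ.< n1) ⊎ (m2 ℤ.< n2) → 1 ≤ a ⊎ 1 ≤ b
  long-segment (inj₁ l) = inj₁ (ℤP.drop‿+<+ (subst₂ ℤ._<_ (ℤP.+-inverseˡ m1) (trans (-j+i≡i-j n1 m1) (sym ea)) (ℤP.+-monoʳ-< (ℤ.- m1) l)))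
  long-segment (inj₂ l) = inj₂ (ℕP.+-cancelˡ-≤ s 1 b (≤≡ (≡≤ (ℕP.+-comm s 1) s<e2) (sym sb)))
    where
    s<e2 : s < e2
    s<e2 = ℤP.drop‿+<+ (subst₂ ℤ._<_ (trans (-j+i≡i-j m2 m1) (sym es)) (trans (-j+i≡i-j n2 m1) (sym ee)) (ℤP.+-monoʳ-< (ℤ.- m1) l))

reflect-InTwoSeg : ∀ a c b m → InTwoSeg (suc a) c (suc b) m →
                   m ≤ suc a + c + b × InTwoSeg (suc b) c (suc a) (suc a + c + b ∸ m)
reflect-InTwoSeg a c b m (inj₁ (_ , s≤s le)) with ℕP.m≤n⇒∃[o]m+o≡n le
... | r , refl = ≤≡ (ℕP.m≤m+n m (suc r + c + b)) (sym (split m r c b)) ,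
                 inj₂ (≤≡ (≤≡ (ℕP.m≤n+m (suc b + c) r) (low r b c)) (sym nm) ,
                       subst (_< suc b + c + suc (m + r)) (sym nm) (≤≡ (s≤s (ℕP.m≤m+n (suc r + c + b) m)) (high m r c b)))
  where
  split : ∀ m r c b → suc (m + r) + c + b ≡ m + (suc r + c + b)
  split = solveℕ
  low : ∀ r b c → r + (suc b + c) ≡ suc r + c + b
  low = solveℕ
  high : ∀ m r c b → suc (suc r + c + b + m) ≡ suc b + c + suc (m + r)
  high = solveℕ
  nm : suc (m + r) + c + b ∸ m ≡ suc r + c + b
  nm = trans (cong (λ q → q ∸ m) (split m r c b)) (ℕP.m+n∸m≡n m (suc r + c + b))
reflect-InTwoSeg a c b m (inj₂ (lo , hi)) with ℕP.m≤n⇒∃[o]m+o≡n lo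
... | j , refl with ℕP.m≤n⇒∃[o]m+o≡n (ℕP.+-cancelˡ-≤ (suc a + c) j b (<+suc⇒≤ {s = suc a + c} {a = b} hi))
...   | r , refl = ≤≡ (ℕP.m≤m+n (suc a + c + j) r) (sym (split a c j r)) ,
                   inj₁ (z≤n , s≤s (≡≤ (trans (cong (λ q → q ∸ (suc a + c + j)) (split a c j r)) (ℕP.m+n∸m≡n (suc a + c + j) r)) (ℕP.m≤n+m r j)))
  where
  split : ∀ a c j r → suc a + c + (j + r) ≡ (suc a + c + j) + r
  split = solveℕ

+m-+n≡+[m∸n] : ∀ m n → n ≤ m → + m ℤ.- + n ≡ + (m ∸ n)
+m-+n≡+[m∸n] m n le = trans (ℤP.m-n≡m⊖n m n) (ℤP.⊖-≥ le)

module Reflect (F : Affine) (A : FinSet ℤ) (a c b : ℕ)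
               (mem0 : ∀ z → z ∈ₛ AffineTransfer.A' F A ⇔ TwoSeg (suc a) c (suc b) z) where
  N : ℕ
  N = suc a + c + b
  reflected : Affine
  reflected = ∘-affine (reflection (+ N)) F
  open Affine F using (f)

  reflected-members : ∀ z → z ∈ₛ AffineTransfer.A' reflected A ⇔ TwoSeg (suc b) c (suc a) z
  reflected-members z = mk⇔ fw bw
    where
    fw : z ∈ₛ AffineTransfer.A' reflected A → TwoSeg (suc b) c (suc a) z
    fw (i , e) with to (mem0 (f (elt A i))) (i , refl)
    ... | m , em , p = N ∸ m , trans (sym e) (trans (cong (λ w → + N ℤ.- w) em) (+m-+n≡+[m∸n] N m (proj₁ (reflect-InTwoSeg a c b m p)))) ,
                      proj₂ (reflect-InTwoSeg a c b m p)
    bw : TwoSeg (suc b) c (suc a) z → z ∈ₛ AffineTransfer.A' reflected A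
    bw (m' , refl , p') = i , trans (cong (λ w → + N ℤ.- w) ei) (trans (+m-+n≡+[m∸n] N (N ∸ m') (ℕP.m∸n≤m N m'))
                                    (cong +_ (ℕP.m∸[m∸n]≡n m'≤N)))
      where
      swap : ∀ a c b → suc b + c + a ≡ suc a + c + b
      swap = solveℕ
      m'≤N : m' ≤ N
      m'≤N = ≤≡ (proj₁ (reflect-InTwoSeg b c a m' p')) (swap a c b)
      pc : InTwoSeg (suc a) c (suc b) (N ∸ m')
      pc = subst (λ q → InTwoSeg (suc a) c (suc b) (q ∸ m')) (swap a c b) (proj₂ (reflect-InTwoSeg b c a m' p'))
      i : Fin (size A)
      i = proj₁ (from (mem0 (+ (N ∸ m'))) (N ∸ m' , refl , pc))
      ei : f (elt A i) ≡ + (N ∸ m')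
      ei = proj₂ (from (mem0 (+ (N ∸ m'))) (N ∸ m' , refl , pc))

-- Gap sets and extremality

gapSet-max : ∀ b c → + (suc (suc b) + c) ℤ.- + 1 ≡ + suc (b + c)
gapSet-max b c = +m-+n≡+[m∸n] (suc (suc b) + c) 1 (s≤s z≤n)

gap-fw : ∀ b c y → GapSet (suc (suc b)) c y → TwoSeg 1 c (suc b) y
gap-fw b c (+ zero) _ = 0 , refl , inj₁ (z≤n , s≤s z≤n)
gap-fw b c (+ suc m) ((lo , hi) , ng) with subst (+ suc m ℤ.≤_) (gapSet-max b c) hi
... | ℤ.+≤+ le with suc m ℕ.≤? c
...   | yes mc = ⊥-elim (ng (ℤ.+≤+ (s≤s z≤n) , ℤ.+≤+ mc))
...   | no nmc = suc m , refl , inj₂ (ℕP.≰⇒> nmc , s≤s (≤≡ le (trans (cong suc (ℕP.+-comm b c)) (sym (ℕP.+-suc c b)))))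
gap-fw b c -[1+ n ] ((() , _) , _)

gap-bw : ∀ b c y → TwoSeg 1 c (suc b) y → GapSet (suc (suc b)) c y
gap-bw b c y (m , refl , inj₁ (_ , s≤s z≤n)) = (ℤ.+≤+ z≤n , subst (+ 0 ℤ.≤_) (sym (gapSet-max b c)) (ℤ.+≤+ z≤n)) , λ { (ℤ.+≤+ () , _) }
gap-bw b c y (m , refl , inj₂ (lo , hi)) =
  (ℤ.+≤+ z≤n , subst (+ m ℤ.≤_) (sym (gapSet-max b c)) (ℤ.+≤+ (≤≡ (<+suc⇒≤ {s = suc c} {a = b} hi) (cong suc (ℕP.+-comm c b))))) ,
  λ { (_ , ℤ.+≤+ mc) → ℕP.<-irrefl refl (ℕP.<-≤-trans lo mc) }

GapSet⇔TwoSeg : ∀ b c y → GapSet (suc (suc b)) c y ⇔ TwoSeg 1 c (suc b) y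
GapSet⇔TwoSeg b c y = mk⇔ (gap-fw b c y) (gap-bw b c y)

gapSet : ℕ → ℕ → FinSet ℤ
gapSet b kk = record { size = suc kk ; elt = gel ; inj = ginj }
  where
  gel : Fin (suc kk) → ℤ
  gel Fin.zero = + 0
  gel (Fin.suc j) = + (suc b + Fin.toℕ j)
  ginj : Injective _≡_ _≡_ gel
  ginj {Fin.zero} {Fin.zero} _ = refl
  ginj {Fin.zero} {Fin.suc j} ()
  ginj {Fin.suc i} {Fin.zero} ()
  ginj {Fin.suc i} {Fin.suc j} eq = cong Fin.suc (FinP.toℕ-injective (ℕP.+-cancelˡ-≡ (suc b) _ _ (ℤP.+-injective eq)))

gapSet-members : ∀ b kk y → y ∈ₛ gapSet b kk ⇔ TwoSeg 1 b kk y
gapSet-members b kk y = mk⇔ fw bw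
  where
  fw : y ∈ₛ gapSet b kk → TwoSeg 1 b kk y
  fw (Fin.zero , refl) = 0 , refl , inj₁ (z≤n , s≤s z≤n)
  fw (Fin.suc j , refl) = suc b + Fin.toℕ j , refl , inj₂ (ℕP.m≤m+n (suc b) _ , ℕP.+-monoʳ-< (suc b) (FinP.toℕ<n j))
  bw : TwoSeg 1 b kk y → y ∈ₛ gapSet b kk
  bw (m , refl , inj₁ (_ , s≤s z≤n)) = Fin.zero , refl
  bw (m , refl , inj₂ (lo , hi)) = Fin.suc (Fin.fromℕ< jlt) ,
      cong +_ (trans (cong (λ q → suc b + q) (FinP.toℕ-fromℕ< jlt)) (ℕP.m+[n∸m]≡n lo))
    where
    jlt : m ∸ suc b < kk
    jlt = ℕP.+-cancelˡ-< (suc b) (m ∸ suc b) kk (≡≤ (cong suc (ℕP.m+[n∸m]≡n lo)) hi)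

gapSet-nonNeg : ∀ b kk → InNat (gapSet b kk)
gapSet-nonNeg b kk Fin.zero = ℤ.+≤+ z≤n
gapSet-nonNeg b kk (Fin.suc j) = ℤ.+≤+ z≤n

module GapSetFacts (b e : ℕ) (A : FinSet ℤ) (memA : ∀ z → z ∈ₛ A ⇔ TwoSeg 1 b (suc (suc (b + e))) z) where
  k : ℕ
  k = suc (suc (suc (b + e)))

  size≡k : size A ≡ k
  size≡k = TwoSegSet.size≡k₁+k₂ 1 b (suc (suc (b + e))) A memA

  isoGapSet : FreimanIsoTo ℤ._+_ ℤ._+_ A (GapSet k b)
  isoGapSet = elt A , inj A ,
              (λ y → mk⇔ (λ g → from (memA y) (to (GapSet⇔TwoSeg (suc (b + e)) b y) g))
                         (λ p → from (GapSet⇔TwoSeg (suc (b + e)) b y) (to (memA y) p))) ,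
              λ i j l m → mk⇔ id id

  dim≡1 : Dim A 1
  dim≡1 = OneDimensional.dim≡1 0 b e A memA

  vol≡k+b : Vol A 1 (k + b)
  vol≡k+b = subst (Vol A 1) (rearrange b e) (OneDimensional.vol≡N+1 0 b e A memA)
    where
    rearrange : ∀ b e → suc (suc b + suc (b + e)) ≡ suc (suc (suc (b + e))) + b
    rearrange = solveℕ

  sumset≡2k+b∸1 : sumsetSizeℤ A ≡ 2 * k + b ∸ 1
  sumset≡2k+b∸1 = SumsetOfGapSet.sumset≡2k+b∸1 b (suc (b + e)) (s≤s (ℕP.m≤m+n b e)) A memA

gapSet-realises : ∀ k b → b + 3 ≤ k →
  Σ (FinSet ℤ) λ G → InNat G × size G ≡ k × sumsetSizeℤ G ≡ 2 * k + b ∸ 1 × Dim G 1 × Vol G 1 (k + b)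
gapSet-realises k b b+3≤k with ℕP.m≤n⇒∃[o]m+o≡n b+3≤k
... | e , refl = subst (λ k → Σ (FinSet ℤ) λ G → InNat G × size G ≡ k × sumsetSizeℤ G ≡ 2 * k + b ∸ 1 × Dim G 1 × Vol G 1 (k + b))
                       (rearrange b e) (G , gapSet-nonNeg b kk , size≡k , sumset≡2k+b∸1 , dim≡1 , vol≡k+b)
  where
  rearrange : ∀ b e → suc (suc (suc (b + e))) ≡ b + 3 + e
  rearrange = solveℕ
  kk : ℕ
  kk = suc (suc (b + e))
  G : FinSet ℤ
  G = gapSet b kk
  open GapSetFacts b e G (gapSet-members b kk)

¬Extremal-longFirstSegment : (A : FinSet ℤ) (F : Affine) (a c e : ℕ) → 1 ≤ c →
  (∀ z → z ∈ₛ AffineTransfer.A' F A ⇔ TwoSeg (suc (suc a)) c (suc (suc (c + e))) z) → ¬ Extremal A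
¬Extremal-longFirstSegment A F a c e 1≤c memA (d , v , dimA , volA , maximal) =
  ℕP.m+n≮m c g (ℕP.+-cancelˡ-≤ K b c (≤≡ K+b≤v v≡K+c))
  where
  open AffineTransfer F A
  module Long = SumsetWithLongSegment a c (suc (c + e)) 1≤c (s≤s (ℕP.m≤m+n c e)) A' memA
  module Line = OneDimensional (suc a) c e A' memA
  K T : ℕ
  K = suc (suc a) + suc (suc (c + e))
  T = sumsetSizeℤ A
  d≡1 : d ≡ 1
  d≡1 = dim-uniq {A = A} dimA (dim-back Line.dim≡1)
  v≡K+c : v ≡ K + c
  v≡K+c = trans (vol-uniq {A = A} (subst (λ q → Vol A q v) d≡1 volA) (vol-back Line.vol≡N+1)) (rearrange a c e)
    where
    rearrange : ∀ a c e → suc (suc (suc a) + c + suc (c + e)) ≡ suc (suc a) + suc (suc (c + e)) + c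
    rearrange = solveℕ
  2K+c≤T : 2 * K + c ≤ T
  2K+c≤T = ≤≡ Long.2k+c≤sumset sumset-eq
  T+4≤3K : T + 4 ≤ 3 * K
  T+4≤3K = ℕP.m≤o∸n⇒m+n≤o T 4≤3K (≡≤ (sym sumset-eq) Long.sumset≤3k∸4)
    where
    4≤3K : 4 ≤ 3 * K
    4≤3K = ℕP.≤-trans (≤≡ (ℕP.m≤m+n 4 (a + c + e)) (rearrange a c e)) (ℕP.m≤m+n K (K + (K + 0)))
      where
      rearrange : ∀ a c e → 4 + (a + c + e) ≡ suc (suc a) + suc (suc (c + e))
      rearrange = solveℕ
  g : ℕ
  g = proj₁ (ℕP.m≤n⇒∃[o]m+o≡n 2K+c≤T)
  2K+c+g≡T : 2 * K + c + g ≡ T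
  2K+c+g≡T = proj₂ (ℕP.m≤n⇒∃[o]m+o≡n 2K+c≤T)
  b : ℕ
  b = suc (c + g)
  b+3≤K : b + 3 ≤ K
  b+3≤K = ℕP.+-cancelˡ-≤ (2 * K) (b + 3) K
            (subst₂ _≤_ (trans (cong (_+ 4) (sym 2K+c+g≡T)) (rearrange₁ K c g)) (rearrange₂ K) T+4≤3K)
    where
    rearrange₁ : ∀ K c g → 2 * K + c + g + 4 ≡ 2 * K + (suc (c + g) + 3)
    rearrange₁ = solveℕ
    rearrange₂ : ∀ K → 3 * K ≡ 2 * K + K
    rearrange₂ = solveℕ
  2K+b∸1≡T : 2 * K + b ∸ 1 ≡ T
  2K+b∸1≡T = trans (≡+⇒∸≡ 1 (rearrange K c g)) 2K+c+g≡T
    where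
    rearrange : ∀ K c g → 2 * K + suc (c + g) ≡ 1 + (2 * K + c + g)
    rearrange = solveℕ
  K+b≤v : K + b ≤ v
  K+b≤v with gapSet-realises K b b+3≤K
  ... | G , G⊆ℕ , size≡K , sumset≡ , dimG , volG =
    maximal G 1 (K + b) G⊆ℕ (trans size≡K (sym (TwoSegSet.size≡k₁+k₂ (suc (suc a)) c (suc (suc (c + e))) A' memA)))
            (trans sumset≡ 2K+b∸1≡T) dimG (sym d≡1) volG

Conclusion : FinSet ℤ → ℕ → Set
Conclusion A k =
    (Σ ℕ λ b → 1 ≤ b × b + 3 ≤ k ×
       FreimanIsoTo ℤ._+_ ℤ._+_ A (GapSet k b) ×
       Dim A 1 × Vol A 1 (k + b) × sumsetSizeℤ A ≡ 2 * k + b ∸ 1)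
    ⊎
    (Σ ℕ λ k₁ → Σ ℕ λ k₂ → k₁ + k₂ ≡ k × 1 ≤ k₁ × 1 ≤ k₂ ×
       FreimanIsoTo ℤ._+_ _+ᵛ_ A (TwoRows k₁ k₂) ×
       Dim A 2 × Vol A 2 k × sumsetSizeℤ A ≡ 3 * k ∸ 3)

twoRows-case : (A : FinSet ℤ) (k : ℕ) (F : Affine) (a c b : ℕ) → a ≤ c → b ≤ c → (1 ≤ a ⊎ 1 ≤ b) →
  (∀ z → z ∈ₛ AffineTransfer.A' F A ⇔ TwoSeg (suc a) c (suc b) z) → k ≡ suc a + suc b → Conclusion A k
twoRows-case A k F a c b a≤c b≤c long memA refl =
  inj₂ (suc a , suc b , refl , s≤s z≤n , s≤s z≤n ,
        isoTo-back {_⊕_ = _+ᵛ_} {S = TwoRows (suc a) (suc b)} Plane.isoTwoRows ,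
        dim-back (Plane.dim≡2 long) , vol-back Plane.vol≡k ,
        trans (sym sumset-eq) (SumsetOfShortSegments.sumset≡3k∸3 a c b a≤c b≤c A' memA))
  where
  open AffineTransfer F A
  module Plane = TwoDimensional a c b a≤c b≤c A' memA

gapSet-case : (A : FinSet ℤ) (F : Affine) (c e : ℕ) → 1 ≤ c →
  (∀ z → z ∈ₛ AffineTransfer.A' F A ⇔ TwoSeg 1 c (suc (suc (c + e))) z) → Conclusion A (suc (suc (suc (c + e))))
gapSet-case A F c e 1≤c memA =
  inj₁ (c , 1≤c , ≤≡ (ℕP.m≤m+n (c + 3) e) (rearrange c e) ,
        isoTo-back {_⊕_ = ℤ._+_} {S = GapSet Gap.k c} Gap.isoGapSet ,
        dim-back Gap.dim≡1 , vol-back Gap.vol≡k+b , trans (sym sumset-eq) Gap.sumset≡2k+b∸1)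
  where
  open AffineTransfer F A
  module Gap = GapSetFacts c e A' memA
  rearrange : ∀ c e → c + 3 + e ≡ suc (suc (suc (c + e)))
  rearrange = solveℕ

longSecond-case : (A : FinSet ℤ) (k : ℕ) (F : Affine) (a c e : ℕ) → 1 ≤ c →
  (∀ z → z ∈ₛ AffineTransfer.A' F A ⇔ TwoSeg (suc a) c (suc (suc (c + e))) z) →
  k ≡ suc a + suc (suc (c + e)) → Extremal A → Conclusion A k
longSecond-case A k F zero c e 1≤c memA refl _ = gapSet-case A F c e 1≤c memA
longSecond-case A k F (suc a) c e 1≤c memA _ ext = ⊥-elim (¬Extremal-longFirstSegment A F a c e 1≤c memA ext)

conclusion-of-normalForm : (A : FinSet ℤ) (k : ℕ) (F : Affine) (a c b : ℕ) → 1 ≤ c → (1 ≤ a ⊎ 1 ≤ b) →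
  (∀ z → z ∈ₛ AffineTransfer.A' F A ⇔ TwoSeg (suc a) c (suc b) z) → k ≡ suc a + suc b → Extremal A → Conclusion A k
conclusion-of-normalForm A k F a c b 1≤c long memA k≡ ext with a ℕ.≤? c | b ℕ.≤? c
... | yes a≤c | yes b≤c = twoRows-case A k F a c b a≤c b≤c long memA k≡
... | _ | no b≰c with ℕP.m≤n⇒∃[o]m+o≡n (ℕP.≰⇒> b≰c)
...   | e , refl = longSecond-case A k F a c e 1≤c memA k≡ ext
conclusion-of-normalForm A k F a c b 1≤c long memA k≡ ext | no a≰c | yes _ with ℕP.m≤n⇒∃[o]m+o≡n (ℕP.≰⇒> a≰c)
...   | e , refl = longSecond-case A k (Reflect.reflected F A (suc (c + e)) c b memA) b c e 1≤c
                     (Reflect.reflected-members F A (suc (c + e)) c b memA)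
                     (trans k≡ (ℕP.+-comm (suc (suc (c + e))) (suc b))) ext

lemma2 : (A : FinSet ℤ) (k : ℕ) → size A ≡ k → Extremal A → UnionOfTwoSegments A →
    (Σ ℕ λ b → 1 ≤ b × b + 3 ≤ k ×
       FreimanIsoTo ℤ._+_ ℤ._+_ A (GapSet k b) ×
       Dim A 1 × Vol A 1 (k + b) × sumsetSizeℤ A ≡ 2 * k + b ∸ 1)
    ⊎
    (Σ ℕ λ k₁ → Σ ℕ λ k₂ → k₁ + k₂ ≡ k × 1 ≤ k₁ × 1 ≤ k₂ ×
       FreimanIsoTo ℤ._+_ _+ᵛ_ A (TwoRows k₁ k₂) ×
       Dim A 2 × Vol A 2 k × sumsetSizeℤ A ≡ 3 * k ∸ 3)
lemma2 A k size≡k extremal (m₁ , n₁ , m₂ , n₂ , m₁≤n₁ , n₁+1<m₂ , m₂≤n₂ , long , memA) =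
  conclusion-of-normalForm A k (translation m₁) a c b 1≤c (long-segment long) members
    (trans (sym size≡k) (TwoSegSet.size≡k₁+k₂ (suc a) c (suc b) A' members)) extremal
  where open Normalise A m₁ n₁ m₂ n₂ m₁≤n₁ n₁+1<m₂ m₂≤n₂ memA
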